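{- Let $c^*\ge 1$ be a constant such that for every positive integer $k$, every graph contains either $k$ pairwise vertex-disjoint cycles or a set of at most $c^* k\log k$ vertices meeting every cycle. Let $k$ be a positive integer and $G$ a graph. Let $P_1$ and $P_2$ be vertex-disjoint paths in $G$, and let $Q_1,\dots,Q_\ell$ be pairwise vertex-disjoint paths in $G$, each with one endpoint in $V(P_1)$ and the other in $V(P_2)$, and each internally disjoint from $V(P_1\cup P_2)$. If $\ell \ge 2 + 3c^* k\log k$, then $P_1\cup P_2\cup\bigcup_{i=1}^{\ell} Q_i$ contains at least $k$ pairwise vertex-disjoint cycles, each of which contains at least two of the paths $Q_1,\dots,Q_\ell$.
   Context: All graphs are finite and simple; logarithms are base 2. A constant $c^*$ as in the hypothesis exists by the Erdős–Pósa theorem.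
   Formalization: The constant $c^*\ge 1$ is taken to be rational, both in the Erdős–Pósa hypothesis and in the threshold on ℓ. -}

module Defs where

open import Level using (0ℓ)
open import Data.Nat using (ℕ; _+_; _*_; _∸_; _^_; _≤_)
open import Data.Fin using (Fin)
open import Data.List using (List; []; _∷_; _++_; length; take)
open import Data.List.Membership.Propositional using (_∈_; _∉_)
open import Data.List.Relation.Unary.Unique.Propositional using (Unique)
open import Data.List.Relation.Unary.Linked using (Linked)
open import Data.Product using (Σ; ∃; ∃-syntax; _×_)
open import Data.Sum using (_⊎_)
open import Data.Empty using (⊥)
open import Relation.Nullary using (¬_)
open import Relation.Binary.PropositionalEquality using (_≡_; _≢_)

record Graph (n : ℕ) : Set₁ where
  field
    Adj    : Fin n → Fin n → Set
    sym    : ∀ {u v} → Adj u v → Adj v u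
    irrefl : ∀ {u} → ¬ Adj u u
open Graph public

data Consec {n : ℕ} : Fin n → Fin n → List (Fin n) → Set where
  here  : ∀ {u v xs} → Consec u v (u ∷ v ∷ xs)
  there : ∀ {u v x xs} → Consec u v xs → Consec u v (x ∷ xs)

IsPath : ∀ {n} → Graph n → List (Fin n) → Set
IsPath G P = (P ≢ []) × Unique P × Linked (Adj G) P

PathEdge : ∀ {n} → List (Fin n) → Fin n → Fin n → Set
PathEdge P u v = Consec u v P ⊎ Consec v u P

closeUp : ∀ {n} → List (Fin n) → List (Fin n)
closeUp C = C ++ take 1 C

IsCycle : ∀ {n} → Graph n → List (Fin n) → Set
IsCycle G C = (3 ≤ length C) × Unique C × Linked (Adj G) (closeUp C)

CycleEdge : ∀ {n} → List (Fin n) → Fin n → Fin n → Set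
CycleEdge C u v = Consec u v (closeUp C) ⊎ Consec v u (closeUp C)

Disjoint : ∀ {n} → List (Fin n) → List (Fin n) → Set
Disjoint A B = ∀ v → v ∈ A → v ∈ B → ⊥

DisjointCycles : ∀ {n} → (k : ℕ) → (List (Fin n) → Set) → Set
DisjointCycles {n} k Good =
  Σ (Fin k → List (Fin n)) λ C →
    (∀ i → Good (C i)) × (∀ i j → i ≢ j → Disjoint (C i) (C j))

FeedbackVertexSet : ∀ {n} → Graph n → List (Fin n) → Set
FeedbackVertexSet G X = ∀ C → IsCycle G C → ∃[ v ] (v ∈ X × v ∈ C)

-- Arithmetic with c* = p / q (rational, q ≥ 1), logarithm base 2.
--   m ≤ (p/q)·k·log₂ k   ⇔   q·m ≤ p·log₂(k^k)   ⇔   2^(q·m) ≤ (k^k)^p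

LeCKlogK : (p q m k : ℕ) → Set
LeCKlogK p q m k = 2 ^ (q * m) ≤ (k ^ k) ^ p

--   ℓ ≥ 2 + 3·(p/q)·k·log₂ k   ⇔   2 ≤ ℓ  and  ((k^k)^p)^3 ≤ 2^(q·(ℓ ∸ 2))
GeTwoPlus3CKlogK : (p q ℓ k : ℕ) → Set
GeTwoPlus3CKlogK p q ℓ k = (2 ≤ ℓ) × (((k ^ k) ^ p) ^ 3 ≤ 2 ^ (q * (ℓ ∸ 2)))

ErdosPosa : (p q : ℕ) → Set₁
ErdosPosa p q = ∀ (k : ℕ) → 1 ≤ k → ∀ (n : ℕ) (G : Graph n) →
  DisjointCycles k (IsCycle G)
  ⊎ (∃[ X ] (FeedbackVertexSet G X × LeCKlogK p q (length X) k))

Connects : ∀ {n} → List (Fin n) → List (Fin n) → List (Fin n) → Set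
Connects {n} P₁ P₂ Q =
  Σ (Fin n) λ a → Σ (Fin n) λ b → Σ (List (Fin n)) λ I →
    (Q ≡ a ∷ (I ++ b ∷ []))
    × ((a ∈ P₁ × b ∈ P₂) ⊎ (a ∈ P₂ × b ∈ P₁))
    × (∀ v → v ∈ I → v ∉ P₁ × v ∉ P₂)

InH-V : ∀ {n ℓ} → List (Fin n) → List (Fin n) → (Fin ℓ → List (Fin n)) → Fin n → Set
InH-V P₁ P₂ Q v = v ∈ P₁ ⊎ v ∈ P₂ ⊎ ∃[ i ] (v ∈ Q i)

InH-E : ∀ {n ℓ} → List (Fin n) → List (Fin n) → (Fin ℓ → List (Fin n)) → Fin n → Fin n → Set
InH-E P₁ P₂ Q u v = PathEdge P₁ u v ⊎ PathEdge P₂ u v ⊎ ∃[ i ] (PathEdge (Q i) u v)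

CycleInH : ∀ {n ℓ} → Graph n → List (Fin n) → List (Fin n) → (Fin ℓ → List (Fin n)) → List (Fin n) → Set
CycleInH G P₁ P₂ Q C =
  IsCycle G C
  × (∀ v → v ∈ C → InH-V P₁ P₂ Q v)
  × (∀ u v → CycleEdge C u v → InH-E P₁ P₂ Q u v)

PathInCycle : ∀ {n} → List (Fin n) → List (Fin n) → Set
PathInCycle R C = (∀ v → v ∈ R → v ∈ C) × (∀ u v → PathEdge R u v → CycleEdge C u v)

ContainsTwo : ∀ {n ℓ} → (Fin ℓ → List (Fin n)) → List (Fin n) → Set
ContainsTwo Q C = ∃[ i ] ∃[ j ] (i ≢ j × PathInCycle (Q i) C × PathInCycle (Q j) C)

-- Contract the interior of every Q j to a single vertex. The result is a ladder whose rails are P₁ and P₂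
-- and whose rungs are paths of length two. Every cycle of the ladder passes through a rung vertex (on the
-- rails alone, a highest vertex of the cycle would have two lower neighbours), and then through a second
-- one, since after crossing from P₁ to P₂ it has to come back. Expanding the rung vertices turns it into a
-- cycle of H containing the two corresponding paths, and disjoint cycles stay disjoint. So it suffices that
-- the ladder has k disjoint cycles. If not, the Erdős–Pósa hypothesis gives a set X of at most c* k log k
-- vertices meeting all its cycles, and then 3|X| + 2 ≤ ℓ. But X spoils at most |X| rungs, and P₁ − X and
-- P₂ − X have at most 2|X| + 2 components; merging components along the at least 2|X| + 2 remaining
-- rungs, some rung must join a component to itself, which yields a cycle avoiding X.

module Submission where

open import Defs hiding (sym)
open import Data.Bool using (Bool; true; false) renaming (_≟_ to _≟ᵇ_)
open import Data.Empty using (⊥; ⊥-elim)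
open import Data.Unit using (⊤; tt)
open import Data.Nat using (ℕ; zero; suc; _+_; _*_; _∸_; _^_; _≤_; _<_; z≤n; s≤s; _≤?_; _<?_)
open import Data.Nat.Properties
  using ( ≤-refl; ≤-reflexive; ≤-trans; ≤-antisym; ≤-total; ≤-pred; <-irrefl; <-≤-trans; ≤-<-trans; <⇒≤; ≤∧≢⇒<
        ; <⇒≱; ≰⇒>; n≮n; 1+n≢n; n≤1+n; m≤n⇒m≤1+n; m≤m+n; m≤n+m; suc-injective
        ; +-suc; +-identityʳ; +-monoˡ-≤; +-monoʳ-≤; +-cancelˡ-≡; +-cancelʳ-≤; m∸n+n≡m
        ; *-assoc; *-comm; *-cancelˡ-≤; ^-monoˡ-≤; ^-monoʳ-<; ^-*-assoc; module ≤-Reasoning )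
  renaming (_≟_ to _≟ℕ_)
open import Data.Nat.Tactic.RingSolver using (solve-∀)
open import Data.Fin using (Fin; toℕ; fromℕ<; join; splitAt) renaming (zero to fzero; suc to fsuc)
open import Data.Fin.Properties using (toℕ-injective; toℕ-fromℕ<; toℕ<n; splitAt-join; join-splitAt) renaming (_≟_ to _≟ᶠ_)
open import Data.List using (List; []; _∷_; _++_; _∷ʳ_; [_]; length; take; reverse; map; filter; lookup; allFin; upTo)
open import Data.List.Properties
  using ( ++-assoc; ++-identityʳ; ∷-injectiveˡ; ∷ʳ-injectiveʳ; length-++; length-++-comm; length-map; length-upTo
        ; length-tabulate; map-++; reverse-++; reverse-involutive; unfold-reverse
        ; filter-accept; filter-reject; filter-all; filter-notAll )
open import Data.List.Extrema.Nat using (argmax; argmax-sel; f[⊥]≤f[argmax]; f[xs]≤f[argmax])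
open import Data.List.Membership.Propositional using (_∈_; _∉_)
open import Data.List.Membership.Propositional.Properties
  using (∈-++⁺ˡ; ∈-++⁺ʳ; ∈-++⁻; ∈-∃++; ∈-filter⁺; ∈-filter⁻; ∈-map⁺; ∈-map⁻; ∈-upTo⁺; ∈-length; ∈-lookup)
open import Data.List.Membership.Setoid.Properties using (index-injective)
open import Data.List.Relation.Binary.Subset.Propositional using (_⊆_)
open import Data.List.Relation.Unary.Any as Any using (here; there)
open import Data.List.Relation.Unary.Any.Properties using (reverse⁺; reverse⁻; lookup-index)
open import Data.List.Relation.Unary.All as All using (All; []; _∷_)
open import Data.List.Relation.Unary.All.Properties using (¬Any⇒All¬) renaming (map⁺ to All-map⁺; ++⁺ to All-++⁺)
open import Data.List.Relation.Unary.AllPairs using (_∷_)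
open import Data.List.Relation.Unary.Unique.Propositional using (Unique; [])
open import Data.List.Relation.Unary.Unique.Propositional.Properties
  using (filter⁺; allFin⁺; Unique[x∷xs]⇒x∉xs) renaming (++⁺ to Unique-++⁺′; map⁺ to Unique-map⁺)
open import Data.List.Relation.Unary.Linked as Linked using (Linked; []; [-]; _∷_)
open import Data.List.Relation.Unary.Linked.Properties using () renaming (map⁺ to Linked-map⁺)
open import Data.Product using (∃-syntax; _×_; _,_; proj₁; proj₂; map₂)
open import Data.Sum as Sum using (_⊎_; inj₁; inj₂; [_,_]′)
open import Function using (_∘_; _∘′_; id; case_of_)
open import Relation.Nullary using (¬_; yes; no; Dec; ¬?)
open import Relation.Nullary.Decidable using (_⊎-dec_)
open import Relation.Unary using (Decidable)
open import Relation.Binary.PropositionalEquality using (_≡_; _≢_; refl; sym; trans; cong; cong₂; subst; subst₂; setoid)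

module _ {A : Set} where

  data Consecutive : A → A → List A → Set where
    here  : ∀ {u v xs} → Consecutive u v (u ∷ v ∷ xs)
    there : ∀ {u v x xs} → Consecutive u v xs → Consecutive u v (x ∷ xs)

  Linked⇒consecutive : ∀ {R : A → A → Set} {xs u v} → Linked R xs → Consecutive u v xs → R u v
  Linked⇒consecutive (r ∷ _) here = r
  Linked⇒consecutive (_ ∷ l) (there c) = Linked⇒consecutive l c

  consecutive⇒Linked : ∀ {R : A → A → Set} xs → (∀ {u v} → Consecutive u v xs → R u v) → Linked R xs
  consecutive⇒Linked [] f = []
  consecutive⇒Linked (x ∷ []) f = [-]
  consecutive⇒Linked (x ∷ y ∷ xs) f = f here ∷ consecutive⇒Linked (y ∷ xs) (λ c → f (there c))

  consecutive-at : ∀ {u v} xs ys → Consecutive u v (xs ++ u ∷ v ∷ ys)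
  consecutive-at [] ys = here
  consecutive-at (x ∷ xs) ys = there (consecutive-at xs ys)

  consecutive-split : ∀ {u v xs} → Consecutive u v xs → ∃[ ys ] ∃[ zs ] (xs ≡ ys ++ u ∷ v ∷ zs)
  consecutive-split (here {xs = xs}) = [] , xs , refl
  consecutive-split (there {x = x} c) with consecutive-split c
  ... | ys , zs , refl = x ∷ ys , zs , refl

  consecutive-++ˡ : ∀ {u v xs} ys → Consecutive u v xs → Consecutive u v (xs ++ ys)
  consecutive-++ˡ ys here = here
  consecutive-++ˡ ys (there c) = there (consecutive-++ˡ ys c)

  consecutive-++ʳ : ∀ {u v} xs {ys} → Consecutive u v ys → Consecutive u v (xs ++ ys)
  consecutive-++ʳ [] c = c
  consecutive-++ʳ (x ∷ xs) c = there (consecutive-++ʳ xs c)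

  consecutive-++⁻ : ∀ {u v} xs y ys → Consecutive u v (xs ++ y ∷ ys) →
    Consecutive u v (xs ∷ʳ y) ⊎ Consecutive u v (y ∷ ys)
  consecutive-++⁻ [] y ys c = inj₂ c
  consecutive-++⁻ (x ∷ []) y ys here = inj₁ here
  consecutive-++⁻ (x ∷ []) y ys (there c) = inj₂ c
  consecutive-++⁻ (x ∷ x′ ∷ xs) y ys here = inj₁ here
  consecutive-++⁻ (x ∷ x′ ∷ xs) y ys (there c) with consecutive-++⁻ (x′ ∷ xs) y ys c
  ... | inj₁ d = inj₁ (there d)
  ... | inj₂ d = inj₂ d

  consecutive-reverse : ∀ {u v xs} → Consecutive u v xs → Consecutive v u (reverse xs)
  consecutive-reverse {u} {v} c with consecutive-split c
  ... | ys , zs , refl = subst (Consecutive v u) (sym reverse-middle) (consecutive-at (reverse zs) (reverse ys))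
    where
    reverse-middle : reverse (ys ++ u ∷ v ∷ zs) ≡ reverse zs ++ v ∷ u ∷ reverse ys
    reverse-middle rewrite reverse-++ ys (u ∷ v ∷ zs) | unfold-reverse u (v ∷ zs) | unfold-reverse v zs
      | ++-assoc (reverse zs) [ v ] [ u ] | ++-assoc (reverse zs) (v ∷ [ u ]) (reverse ys) = refl

  Linked-join : ∀ {R : A → A → Set} xs {y ys} → Linked R (xs ∷ʳ y) → Linked R (y ∷ ys) → Linked R (xs ++ y ∷ ys)
  Linked-join [] l₁ l₂ = l₂
  Linked-join (x ∷ []) (r ∷ _) l₂ = r ∷ l₂
  Linked-join (x ∷ x′ ∷ xs) (r ∷ l₁) l₂ = r ∷ Linked-join (x′ ∷ xs) l₁ l₂

  Unique-cons : ∀ {x : A} {xs} → x ∉ xs → Unique xs → Unique (x ∷ xs)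
  Unique-cons {xs = xs} x∉xs u = ¬Any⇒All¬ xs x∉xs ∷ u

  Unique-tail : ∀ {x : A} {xs} → Unique (x ∷ xs) → Unique xs
  Unique-tail (_ ∷ u) = u

  Unique-++⁺ : ∀ {xs ys : List A} → Unique xs → Unique ys → (∀ {v} → v ∈ xs → v ∉ ys) → Unique (xs ++ ys)
  Unique-++⁺ u₁ u₂ disjoint = Unique-++⁺′ u₁ u₂ (λ (p , q) → disjoint p q)

  Unique-++⁻ˡ : ∀ xs {ys} → Unique (xs ++ ys) → Unique xs
  Unique-++⁻ˡ [] _ = []
  Unique-++⁻ˡ (x ∷ xs) u = Unique-cons (λ m → Unique[x∷xs]⇒x∉xs u (∈-++⁺ˡ m)) (Unique-++⁻ˡ xs (Unique-tail u))

  Unique-++⁻ʳ : ∀ xs {ys} → Unique (xs ++ ys) → Unique ys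
  Unique-++⁻ʳ [] u = u
  Unique-++⁻ʳ (x ∷ xs) u = Unique-++⁻ʳ xs (Unique-tail u)

  Unique-++⇒disjoint : ∀ xs {ys v} → Unique (xs ++ ys) → v ∈ xs → v ∉ ys
  Unique-++⇒disjoint (x ∷ xs) u (here refl) m = Unique[x∷xs]⇒x∉xs u (∈-++⁺ʳ xs m)
  Unique-++⇒disjoint (x ∷ xs) u (there m′) m = Unique-++⇒disjoint xs (Unique-tail u) m′ m

  Unique-++-comm : ∀ xs ys → Unique (xs ++ ys) → Unique (ys ++ xs)
  Unique-++-comm xs ys u =
    Unique-++⁺ {ys} {xs} (Unique-++⁻ʳ xs u) (Unique-++⁻ˡ xs u) (λ p q → Unique-++⇒disjoint xs u q p)

  Unique-reverse : ∀ xs → Unique xs → Unique (reverse xs)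
  Unique-reverse [] u = u
  Unique-reverse (x ∷ xs) u rewrite unfold-reverse x xs =
    Unique-++⁺ {reverse xs} (Unique-reverse xs (Unique-tail u)) (Unique-cons (λ ()) [])
      (λ { m (here refl) → Unique[x∷xs]⇒x∉xs u (reverse⁻ m) })

  ∈-++-comm : ∀ {v : A} xs ys → v ∈ ys ++ xs → v ∈ xs ++ ys
  ∈-++-comm xs ys m with ∈-++⁻ ys m
  ... | inj₁ p = ∈-++⁺ʳ xs p
  ... | inj₂ q = ∈-++⁺ˡ q

  ∷-as-∷ʳ : ∀ (x : A) xs → ∃[ ys ] ∃[ y ] (x ∷ xs ≡ ys ∷ʳ y)
  ∷-as-∷ʳ x [] = [] , x , refl
  ∷-as-∷ʳ x (x′ ∷ xs) with ∷-as-∷ʳ x′ xs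
  ... | ys , y , eq = x ∷ ys , y , cong (x ∷_) eq

  3≤length : ∀ {x y z : A} {xs} → x ∈ xs → y ∈ xs → z ∈ xs → x ≢ y → x ≢ z → y ≢ z → 3 ≤ length xs
  3≤length {x} mx my mz x≢y x≢z y≢z with ∈-∃++ mx
  ... | ys , zs , refl = subst (3 ≤_) (sym (length-++ ys)) (subst (3 ≤_) (length-remove ys zs)
        (s≤s (2≤length (remove my (x≢y ∘′ sym)) (remove mz (x≢z ∘′ sym)) y≢z)))
    where
    remove : ∀ {w} → w ∈ ys ++ x ∷ zs → w ≢ x → w ∈ ys ++ zs
    remove m w≢x with ∈-++⁻ ys m
    ... | inj₁ p = ∈-++⁺ˡ p
    ... | inj₂ (here e) = ⊥-elim (w≢x e)
    ... | inj₂ (there q) = ∈-++⁺ʳ ys q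
    length-remove : ∀ ys zs → suc (length (ys ++ zs)) ≡ length ys + length (x ∷ zs)
    length-remove [] zs = refl
    length-remove (_ ∷ ys) zs = cong suc (length-remove ys zs)
    2≤length : ∀ {u w : A} {xs} → u ∈ xs → w ∈ xs → u ≢ w → 2 ≤ length xs
    2≤length {xs = _ ∷ []} (here refl) (here refl) u≢w = ⊥-elim (u≢w refl)
    2≤length {xs = _ ∷ []} (there ()) _ _
    2≤length {xs = _ ∷ []} _ (there ()) _
    2≤length {xs = _ ∷ _ ∷ _} _ _ _ = s≤s (s≤s z≤n)

  closeCycle : List A → List A
  closeCycle C = C ++ take 1 C

  IsCycleOf : (A → A → Set) → List A → Set
  IsCycleOf R C = 3 ≤ length C × Unique C × Linked R (closeCycle C)

  consecutive-rotate : ∀ {u v} xs ys →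
    Consecutive u v (closeCycle (ys ++ xs)) → Consecutive u v (closeCycle (xs ++ ys))
  consecutive-rotate [] ys c rewrite ++-identityʳ ys = c
  consecutive-rotate (x ∷ xs) [] c rewrite ++-identityʳ xs = c
  consecutive-rotate (x ∷ xs) (y ∷ ys) c
    rewrite ++-assoc (x ∷ xs) (y ∷ ys) [ x ] | ++-assoc (y ∷ ys) (x ∷ xs) [ y ]
    with consecutive-++⁻ (y ∷ ys) x (xs ∷ʳ y) c
  ... | inj₁ d = consecutive-++ʳ (x ∷ xs) d
  ... | inj₂ d = subst (Consecutive _ _) (++-assoc (x ∷ xs) [ y ] (ys ∷ʳ x)) (consecutive-++ˡ (ys ∷ʳ x) d)

  IsCycleOf-rotate : ∀ {R : A → A → Set} xs ys → IsCycleOf R (xs ++ ys) → IsCycleOf R (ys ++ xs)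
  IsCycleOf-rotate xs ys (3≤ , u , linked) =
    subst (3 ≤_) (length-++-comm xs ys) 3≤ , Unique-++-comm xs ys u ,
    consecutive⇒Linked _ (λ c → Linked⇒consecutive linked (consecutive-rotate xs ys c))

  data Walk (R : A → A → Set) : A → A → List A → Set where
    end  : ∀ {x} → Walk R x x [ x ]
    step : ∀ {x y z xs} → R x y → Walk R y z xs → Walk R x z (x ∷ xs)

  module _ {R : A → A → Set} where

    Walk⇒Linked : ∀ {x y xs} → Walk R x y xs → Linked R xs
    Walk⇒Linked end = [-]
    Walk⇒Linked (step r end) = r ∷ [-]
    Walk⇒Linked (step r w@(step _ _)) = r ∷ Walk⇒Linked w

    Walk-join : ∀ {x y z w xs ys} → Walk R x y xs → R y z → Walk R z w ys → Walk R x w (xs ++ ys)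
    Walk-join end r w₂ = step r w₂
    Walk-join (step r′ w₁) r w₂ = step r′ (Walk-join w₁ r w₂)

    Walk-reverse : (∀ {a b} → R a b → R b a) → ∀ {x y xs} → Walk R x y xs → Walk R y x (reverse xs)
    Walk-reverse R-sym end = end
    Walk-reverse R-sym (step {x = x} {xs = xs} r w) rewrite unfold-reverse x xs = Walk-join (Walk-reverse R-sym w) (R-sym r) end

    2≤length-Walk : ∀ {x y xs} → Walk R x y xs → x ≢ y → 2 ≤ length xs
    2≤length-Walk end x≢y = ⊥-elim (x≢y refl)
    2≤length-Walk (step _ end) _ = s≤s (s≤s z≤n)
    2≤length-Walk (step _ (step _ _)) _ = s≤s (s≤s z≤n)

  head-neighbours : ∀ {R : A → A → Set} x zs → IsCycleOf R (x ∷ zs) →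
    ∃[ y ] ∃[ z ] (R x y × R z x × y ≢ z × y ∈ zs × z ∈ zs)
  head-neighbours x (z₀ ∷ []) (s≤s (s≤s ()) , _)
  head-neighbours {R} x (z₀ ∷ z₁ ∷ zs) (_ , u , linked) with ∷-as-∷ʳ z₁ zs
  ... | ys , z , eq = z₀ , z , Linked⇒consecutive linked here , R-zx , z₀≢z , here refl , z∈
    where
    eq′ : z₀ ∷ z₁ ∷ zs ≡ (z₀ ∷ ys) ∷ʳ z
    eq′ = cong (z₀ ∷_) eq
    closed : closeCycle (x ∷ z₀ ∷ z₁ ∷ zs) ≡ (x ∷ z₀ ∷ ys) ++ z ∷ [ x ]
    closed = trans (cong (λ l → x ∷ z₀ ∷ l ++ [ x ]) eq) (cong (λ l → x ∷ z₀ ∷ l) (++-assoc ys [ z ] [ x ]))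
    R-zx : R z x
    R-zx = Linked⇒consecutive linked (subst (Consecutive z x) (sym closed) (consecutive-at (x ∷ z₀ ∷ ys) []))
    z₀≢z : z₀ ≢ z
    z₀≢z e = Unique-++⇒disjoint (z₀ ∷ ys) (subst Unique eq′ (Unique-tail u)) (here refl) (here e)
    z∈ : z ∈ z₀ ∷ z₁ ∷ zs
    z∈ = subst (z ∈_) (sym eq′) (∈-++⁺ʳ (z₀ ∷ ys) (here refl))

  side-change : (f : A → Bool) → ∀ x xs y → f x ≢ f y →
    ∃[ as ] ∃[ u ] ∃[ v ] ∃[ bs ] (x ∷ xs ∷ʳ y ≡ as ++ u ∷ v ∷ bs × f u ≢ f v)
  side-change f x [] y fx≢fy = [] , x , y , [] , refl , fx≢fy
  side-change f x (x′ ∷ xs) y fx≢fy with f x ≟ᵇ f x′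
  ... | no fx≢fx′ = [] , x , x′ , xs ∷ʳ y , refl , fx≢fx′
  ... | yes fx≡fx′ with side-change f x′ xs y (λ e → fx≢fy (trans fx≡fx′ e))
  ...   | as , u , v , bs , eq , fu≢fv = x ∷ as , u , v , bs , cong (x ∷_) eq , fu≢fv

module _ {A B : Set} {R : A → A → Set} {S : B → B → Set} (f : A → B) (f-hom : ∀ {x y} → R x y → S (f x) (f y)) where

  Walk-map : ∀ {x y xs} → Walk R x y xs → Walk S (f x) (f y) (map f xs)
  Walk-map end = end
  Walk-map (step r w) = step (f-hom r) (Walk-map w)

module _ {A : Set} {P : A → Set} (P? : Decidable P) where

  filter-removes-at-most-one : ∀ {xs} → Unique xs → (∀ {y z} → y ∈ xs → z ∈ xs → P y → P z → y ≡ z) →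
    length xs ≤ suc (length (filter (¬? ∘ P?) xs))
  filter-removes-at-most-one {[]} _ _ = z≤n
  filter-removes-at-most-one {x ∷ xs} u at-most-one = case P? x of λ where
    (yes px) → ≤-reflexive (cong (suc ∘ length) (sym (trans (filter-reject (¬? ∘ P?) (λ ¬px → ¬px px))
                 (filter-all (¬? ∘ P?) (All.tabulate (λ {y} y∈ py → Unique[x∷xs]⇒x∉xs u
                   (subst (_∈ xs) (at-most-one (there y∈) (here refl) py px) y∈)))))))
    (no ¬px) → subst (λ ys → suc (length xs) ≤ suc (length ys)) (sym (filter-accept (¬? ∘ P?) ¬px))
                 (s≤s (filter-removes-at-most-one (Unique-tail u) (λ y∈ z∈ → at-most-one (there y∈) (there z∈))))


module _ {A B : Set} {R : A → A → Set} {S : B → B → Set} (f : A → B)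
  (f-injective : ∀ {x y} → f x ≡ f y → x ≡ y) (f-hom : ∀ {x y} → R x y → S (f x) (f y)) where

  IsCycleOf-map : ∀ {C} → IsCycleOf R C → IsCycleOf S (map f C)
  IsCycleOf-map {C} (3≤ , u , linked) =
    subst (3 ≤_) (sym (length-map f C)) 3≤ , Unique-map⁺ f-injective u ,
    subst (Linked S) (map-closeCycle C) (Linked-map⁺ (Linked.map f-hom linked))
    where
    map-closeCycle : ∀ C → map f (closeCycle C) ≡ closeCycle (map f C)
    map-closeCycle [] = refl
    map-closeCycle (x ∷ xs) = cong (f x ∷_) (map-++ f xs [ x ])

-- The ladder

Neighbours : ∀ {k} → Fin k → Fin k → Set
Neighbours i i′ = toℕ i′ ≡ suc (toℕ i) ⊎ toℕ i ≡ suc (toℕ i′)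

Neighbours-sym : ∀ {k} {i i′ : Fin k} → Neighbours i i′ → Neighbours i′ i
Neighbours-sym = Sum.swap

module Ladder (s t ℓ : ℕ) (at₁ : Fin ℓ → Fin s) (at₂ : Fin ℓ → Fin t) where

  data Vertex : Set where
    rail₁ : Fin s → Vertex
    rail₂ : Fin t → Vertex
    rung  : Fin ℓ → Vertex

  end₁ end₂ : Fin ℓ → Vertex
  end₁ j = rail₁ (at₁ j)
  end₂ j = rail₂ (at₂ j)

  infix 4 _∼_
  _∼_ : Vertex → Vertex → Set
  rail₁ i ∼ rail₁ i′ = Neighbours i i′
  rail₂ i ∼ rail₂ i′ = Neighbours i i′
  rail₁ i ∼ rung j = at₁ j ≡ i
  rung j ∼ rail₁ i = at₁ j ≡ i
  rail₂ i ∼ rung j = at₂ j ≡ i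
  rung j ∼ rail₂ i = at₂ j ≡ i
  rail₁ _ ∼ rail₂ _ = ⊥
  rail₂ _ ∼ rail₁ _ = ⊥
  rung _ ∼ rung _ = ⊥

  ∼-sym : ∀ {x y} → x ∼ y → y ∼ x
  ∼-sym {rail₁ _} {rail₁ _} = Neighbours-sym
  ∼-sym {rail₂ _} {rail₂ _} = Neighbours-sym
  ∼-sym {rail₁ _} {rung _} e = e
  ∼-sym {rung _} {rail₁ _} e = e
  ∼-sym {rail₂ _} {rung _} e = e
  ∼-sym {rung _} {rail₂ _} e = e

  ∼-irrefl : ∀ {x} → x ∼ x → ⊥
  ∼-irrefl {rail₁ _} (inj₁ e) = 1+n≢n (sym e)
  ∼-irrefl {rail₁ _} (inj₂ e) = 1+n≢n (sym e)
  ∼-irrefl {rail₂ _} (inj₁ e) = 1+n≢n (sym e)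
  ∼-irrefl {rail₂ _} (inj₂ e) = 1+n≢n (sym e)

  rail₁-injective : ∀ {i j} → rail₁ i ≡ rail₁ j → i ≡ j
  rail₁-injective refl = refl

  rail₂-injective : ∀ {i j} → rail₂ i ≡ rail₂ j → i ≡ j
  rail₂-injective refl = refl

  rung-injective : ∀ {i j} → rung i ≡ rung j → i ≡ j
  rung-injective refl = refl

  _≟_ : (x y : Vertex) → Dec (x ≡ y)
  rail₁ i ≟ rail₁ j with i ≟ᶠ j
  ... | yes refl = yes refl
  ... | no i≢j = no (λ e → i≢j (rail₁-injective e))
  rail₂ i ≟ rail₂ j with i ≟ᶠ j
  ... | yes refl = yes refl
  ... | no i≢j = no (λ e → i≢j (rail₂-injective e))
  rung i ≟ rung j with i ≟ᶠ j
  ... | yes refl = yes refl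
  ... | no i≢j = no (λ e → i≢j (rung-injective e))
  rail₁ _ ≟ rail₂ _ = no λ ()
  rail₁ _ ≟ rung _ = no λ ()
  rail₂ _ ≟ rail₁ _ = no λ ()
  rail₂ _ ≟ rung _ = no λ ()
  rung _ ≟ rail₁ _ = no λ ()
  rung _ ≟ rail₂ _ = no λ ()

  OnRail : Vertex → Set
  OnRail (rung _) = ⊥
  OnRail _ = ⊤

  rung≢OnRail : ∀ {j v} → OnRail v → rung j ≢ v
  rung≢OnRail {v = rail₁ _} _ ()
  rung≢OnRail {v = rail₂ _} _ ()

  rung-ends : ∀ {j v} → rung j ∼ v → v ≡ end₁ j ⊎ v ≡ end₂ j
  rung-ends {v = rail₁ _} refl = inj₁ refl
  rung-ends {v = rail₂ _} refl = inj₂ refl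

  rung-neighbour-OnRail : ∀ {j v} → rung j ∼ v → OnRail v
  rung-neighbour-OnRail {v = rail₁ _} _ = tt
  rung-neighbour-OnRail {v = rail₂ _} _ = tt

  -- Rungs count as lying on the first rail, so the side changes only along edges between a rung and the second rail.
  side : Vertex → Bool
  side (rail₂ _) = false
  side _ = true

  rung-crosses : ∀ {j x y} → x ∼ rung j → rung j ∼ y → x ≢ y → side x ≢ side y
  rung-crosses x∼ ∼y x≢y with rung-ends (∼-sym x∼) | rung-ends ∼y
  ... | inj₁ refl | inj₁ refl = ⊥-elim (x≢y refl)
  ... | inj₁ refl | inj₂ refl = λ ()
  ... | inj₂ refl | inj₁ refl = λ ()
  ... | inj₂ refl | inj₂ refl = ⊥-elim (x≢y refl)

  height : Vertex → ℕ
  height (rail₁ i) = toℕ i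
  height (rail₂ i) = toℕ i
  height (rung _) = 0

  lower-neighbour-unique : ∀ {x y z} → x ∼ y → x ∼ z → OnRail x → OnRail y → OnRail z →
    height y ≤ height x → height z ≤ height x → y ≡ z
  lower-neighbour-unique {rail₁ _} {rail₁ _} {rail₁ _} (inj₁ e) _ _ _ _ y≤ _ = ⊥-elim (n≮n _ (subst (_≤ _) e y≤))
  lower-neighbour-unique {rail₁ _} {rail₁ _} {rail₁ _} (inj₂ _) (inj₁ e′) _ _ _ _ z≤ =
    ⊥-elim (n≮n _ (subst (_≤ _) e′ z≤))
  lower-neighbour-unique {rail₁ _} {rail₁ _} {rail₁ _} (inj₂ e) (inj₂ e′) _ _ _ _ _ =
    cong rail₁ (toℕ-injective (suc-injective (trans (sym e) e′)))
  lower-neighbour-unique {rail₂ _} {rail₂ _} {rail₂ _} (inj₁ e) _ _ _ _ y≤ _ = ⊥-elim (n≮n _ (subst (_≤ _) e y≤))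
  lower-neighbour-unique {rail₂ _} {rail₂ _} {rail₂ _} (inj₂ _) (inj₁ e′) _ _ _ _ z≤ =
    ⊥-elim (n≮n _ (subst (_≤ _) e′ z≤))
  lower-neighbour-unique {rail₂ _} {rail₂ _} {rail₂ _} (inj₂ e) (inj₂ e′) _ _ _ _ _ =
    cong rail₂ (toℕ-injective (suc-injective (trans (sym e) e′)))
  lower-neighbour-unique {rail₁ _} {rung _} _ _ _ ()
  lower-neighbour-unique {rail₂ _} {rung _} _ _ _ ()
  lower-neighbour-unique {rail₁ _} {rail₁ _} {rung _} _ _ _ _ ()
  lower-neighbour-unique {rail₂ _} {rail₂ _} {rung _} _ _ _ _ ()
  lower-neighbour-unique {rung _} _ _ ()

  rail-cycle-impossible : ∀ C → IsCycleOf _∼_ C → All OnRail C → ⊥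
  rail-cycle-impossible [] (() , _)
  rail-cycle-impossible C@(c ∷ cs) cycle onRail = at-highest (∈-∃++ x∈C)
    where
    x = argmax height c cs
    x∈C : x ∈ C
    x∈C with argmax-sel height c cs
    ... | inj₁ e = here e
    ... | inj₂ m = there m
    highest : ∀ {v} → v ∈ C → height v ≤ height x
    highest (here refl) = f[⊥]≤f[argmax] {f = height} c cs
    highest (there m) = All.lookup (f[xs]≤f[argmax] {f = height} c cs) m
    at-highest : ∃[ as ] ∃[ bs ] (C ≡ as ++ [ x ] ++ bs) → ⊥
    at-highest (as , bs , eq)
      with head-neighbours x (bs ++ as) (IsCycleOf-rotate as (x ∷ bs) (subst (IsCycleOf _∼_) eq cycle))
    ... | y , z , x∼y , z∼x , y≢z , y∈ , z∈ = y≢z (lower-neighbour-unique x∼y (∼-sym z∼x)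
          (All.lookup onRail x∈C) (All.lookup onRail (back y∈)) (All.lookup onRail (back z∈))
          (highest (back y∈)) (highest (back z∈)))
      where
      back : ∀ {v} → v ∈ bs ++ as → v ∈ C
      back m = subst (_ ∈_) (sym eq) (∈-++-comm as (x ∷ bs) (there m))

  rung-or-OnRail : ∀ C → (∃[ j ] rung j ∈ C) ⊎ All OnRail C
  rung-or-OnRail [] = inj₂ []
  rung-or-OnRail (rung j ∷ C) = inj₁ (j , here refl)
  rung-or-OnRail (rail₁ i ∷ C) = Sum.map (map₂ there) (tt ∷_) (rung-or-OnRail C)
  rung-or-OnRail (rail₂ i ∷ C) = Sum.map (map₂ there) (tt ∷_) (rung-or-OnRail C)

  cycle-has-rung : ∀ C → IsCycleOf _∼_ C → ∃[ j ] rung j ∈ C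
  cycle-has-rung C cycle with rung-or-OnRail C
  ... | inj₁ r = r
  ... | inj₂ onRail = ⊥-elim (rail-cycle-impossible C cycle onRail)

  AroundRung : Fin ℓ → List Vertex → Set
  AroundRung j C = ∃[ p ] ∃[ y ] ∃[ rest ] (IsCycleOf _∼_ (p ∷ rung j ∷ y ∷ rest) × p ∷ rung j ∷ y ∷ rest ⊆ C)

  around-rung-at-head : ∀ {j} zs → IsCycleOf _∼_ (rung j ∷ zs) → AroundRung j (rung j ∷ zs)
  around-rung-at-head [] (s≤s () , _)
  around-rung-at-head (_ ∷ []) (s≤s (s≤s ()) , _)
  around-rung-at-head {j} (y ∷ z ∷ zs) cycle with ∷-as-∷ʳ z zs
  ... | rest , p , eq = p , y , rest ,
        IsCycleOf-rotate (rung j ∷ y ∷ rest) [ p ] (subst (IsCycleOf _∼_) eq′ cycle) ,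
        λ {v} m → subst (v ∈_) (sym eq′) (∈-++-comm (rung j ∷ y ∷ rest) [ p ] m)
    where
    eq′ : rung j ∷ y ∷ z ∷ zs ≡ (rung j ∷ y ∷ rest) ∷ʳ p
    eq′ = cong (λ zs′ → rung j ∷ y ∷ zs′) eq

  around-rung : ∀ {j} C → IsCycleOf _∼_ C → rung j ∈ C → AroundRung j C
  around-rung {j} C cycle m with ∈-∃++ m
  ... | as , bs , refl with around-rung-at-head (bs ++ as) (IsCycleOf-rotate as (rung j ∷ bs) cycle)
  ...   | p , y , rest , cycle′ , ⊆C = p , y , rest , cycle′ , λ m′ → ∈-++-comm as (rung j ∷ bs) (⊆C m′)

  side-change-at-rung : ∀ {u v} → u ∼ v → side u ≢ side v →
    (∃[ j ] (u ≡ rung j × OnRail v)) ⊎ (∃[ j ] (v ≡ rung j × OnRail u))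
  side-change-at-rung {rail₁ _} {rail₁ _} _ ne = ⊥-elim (ne refl)
  side-change-at-rung {rail₂ _} {rail₂ _} _ ne = ⊥-elim (ne refl)
  side-change-at-rung {rail₁ _} {rung _} _ ne = ⊥-elim (ne refl)
  side-change-at-rung {rung _} {rail₁ _} _ ne = ⊥-elim (ne refl)
  side-change-at-rung {rail₂ _} {rung j} _ _ = inj₂ (j , refl , tt)
  side-change-at-rung {rung j} {rail₂ _} _ _ = inj₁ (j , refl , tt)

  record PassesRung (zs : List Vertex) : Set where
    field
      before : List Vertex
      x : Vertex
      j : Fin ℓ
      y : Vertex
      after : List Vertex
      split : zs ≡ before ++ x ∷ rung j ∷ y ∷ after
      x∼j : x ∼ rung j
      j∼y : rung j ∼ y
      x≢y : x ≢ y

  passes-rung-at : ∀ zs → Linked _∼_ zs → Unique zs → ∀ as x j y bs → zs ≡ as ++ x ∷ rung j ∷ y ∷ bs →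
    PassesRung zs
  passes-rung-at zs linked u as x j y bs split = record
    { before = as ; x = x ; j = j ; y = y ; after = bs ; split = split
    ; x∼j = Linked⇒consecutive linked (subst (Consecutive x (rung j)) (sym split) (consecutive-at as (y ∷ bs)))
    ; j∼y = Linked⇒consecutive linked (subst (Consecutive (rung j) y) (sym split)
              (subst (Consecutive (rung j) y) (++-assoc as [ x ] (rung j ∷ y ∷ bs)) (consecutive-at (as ∷ʳ x) bs)))
    ; x≢y = λ x≡y → Unique[x∷xs]⇒x∉xs (Unique-++⁻ʳ as (subst Unique split u)) (there (here x≡y))
    }

  passes-rung-between-sides : ∀ y rest p → OnRail y → OnRail p →
    Linked _∼_ (y ∷ rest ∷ʳ p) → Unique (y ∷ rest ∷ʳ p) → side y ≢ side p → PassesRung (y ∷ rest ∷ʳ p)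
  passes-rung-between-sides y rest p y-on p-on linked u sy≢sp with side-change side y rest p sy≢sp
  ... | as , a , b , bs , split , sa≢sb =
    at-rung as a b bs split (side-change-at-rung (Linked⇒consecutive linked
      (subst (Consecutive a b) (sym split) (consecutive-at as bs))) sa≢sb)
    where
    zs = y ∷ rest ∷ʳ p
    at-rung : ∀ as a b bs → zs ≡ as ++ a ∷ b ∷ bs →
      (∃[ j ] (a ≡ rung j × OnRail b)) ⊎ (∃[ j ] (b ≡ rung j × OnRail a)) → PassesRung zs
    at-rung [] a b bs split (inj₁ (j , refl , _)) = ⊥-elim (rung≢OnRail y-on (sym (∷-injectiveˡ split)))
    at-rung (a₀ ∷ as) a b bs split (inj₁ (j , refl , _)) with ∷-as-∷ʳ a₀ as
    ... | as′ , x , e = passes-rung-at zs linked u as′ x j b bs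
          (trans split (trans (cong (_++ rung j ∷ b ∷ bs) e) (++-assoc as′ [ x ] (rung j ∷ b ∷ bs))))
    at-rung as a b [] split (inj₂ (j , refl , _)) = ⊥-elim (rung≢OnRail p-on
      (sym (∷ʳ-injectiveʳ (y ∷ rest) (as ∷ʳ a) (trans split (sym (++-assoc as [ a ] [ rung j ]))))))
    at-rung as a b (y′ ∷ bs) split (inj₂ (j , refl , _)) = passes-rung-at zs linked u as a j y′ bs split

  record TwoRungs (C : List Vertex) : Set where
    field
      p y : Vertex
      j : Fin ℓ
      rest : List Vertex
      cycle : IsCycleOf _∼_ (p ∷ rung j ∷ y ∷ rest)
      ⊆C : p ∷ rung j ∷ y ∷ rest ⊆ C
      p∼j : p ∼ rung j
      j∼y : rung j ∼ y
      p≢y : p ≢ y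
      second : PassesRung (y ∷ rest ∷ʳ p)
      j≢j′ : j ≢ PassesRung.j second

  cycle-has-two-rungs : ∀ C → IsCycleOf _∼_ C → TwoRungs C
  cycle-has-two-rungs C cycle with cycle-has-rung C cycle
  ... | j , m with around-rung C cycle m
  ... | p , y , rest , cycle′@(_ , u , p∼j ∷ j∼y ∷ linked) , ⊆C = record
    { p = p ; y = y ; j = j ; rest = rest ; cycle = cycle′ ; ⊆C = ⊆C ; p∼j = p∼j ; j∼y = j∼y
    ; p≢y = p≢y ; second = second ; j≢j′ = j≢j′ }
    where
    p≢y : p ≢ y
    p≢y e = Unique[x∷xs]⇒x∉xs u (there (here e))
    p-on = rung-neighbour-OnRail (∼-sym p∼j)
    second : PassesRung (y ∷ rest ∷ʳ p)
    second = passes-rung-between-sides y rest p (rung-neighbour-OnRail j∼y) p-on linked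
      (Unique-++⁺ (Unique-tail (Unique-tail u)) (Unique-cons (λ ()) [])
        (λ { m (here refl) → Unique[x∷xs]⇒x∉xs u (there m) }))
      (λ e → rung-crosses p∼j j∼y p≢y (sym e))
    j≢j′ : j ≢ PassesRung.j second
    j≢j′ j≡j′ with ∈-++⁻ (y ∷ rest) (subst (rung j ∈_) (sym (PassesRung.split second))
                    (∈-++⁺ʳ (PassesRung.before second) (there (here (cong rung j≡j′)))))
    ... | inj₁ m = Unique[x∷xs]⇒x∉xs (Unique-tail u) m
    ... | inj₂ (here e) = rung≢OnRail p-on e

  encode : Vertex → Fin (s + (t + ℓ))
  encode (rail₁ i) = join s (t + ℓ) (inj₁ i)
  encode (rail₂ i) = join s (t + ℓ) (inj₂ (join t ℓ (inj₁ i)))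
  encode (rung j) = join s (t + ℓ) (inj₂ (join t ℓ (inj₂ j)))

  decode : Fin (s + (t + ℓ)) → Vertex
  decode x with splitAt s x
  ... | inj₁ i = rail₁ i
  ... | inj₂ y with splitAt t y
  ...   | inj₁ i = rail₂ i
  ...   | inj₂ j = rung j

  decode-encode : ∀ v → decode (encode v) ≡ v
  decode-encode (rail₁ i) rewrite splitAt-join s (t + ℓ) (inj₁ i) = refl
  decode-encode (rail₂ i) rewrite splitAt-join s (t + ℓ) (inj₂ (join t ℓ (inj₁ i))) | splitAt-join t ℓ (inj₁ i) = refl
  decode-encode (rung j) rewrite splitAt-join s (t + ℓ) (inj₂ (join t ℓ (inj₂ j))) | splitAt-join t ℓ (inj₂ j) = refl

  encode-decode : ∀ x → encode (decode x) ≡ x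
  encode-decode x with splitAt s x in e
  ... | inj₁ i = trans (cong (join s (t + ℓ)) (sym e)) (join-splitAt s (t + ℓ) x)
  ... | inj₂ y with splitAt t y in e′
  ...   | inj₁ i = trans (cong (λ z → join s (t + ℓ) (inj₂ z)) (trans (cong (join t ℓ) (sym e′)) (join-splitAt t ℓ y)))
                     (trans (cong (join s (t + ℓ)) (sym e)) (join-splitAt s (t + ℓ) x))
  ...   | inj₂ j = trans (cong (λ z → join s (t + ℓ) (inj₂ z)) (trans (cong (join t ℓ) (sym e′)) (join-splitAt t ℓ y)))
                     (trans (cong (join s (t + ℓ)) (sym e)) (join-splitAt s (t + ℓ) x))

  encode-injective : ∀ {v w} → encode v ≡ encode w → v ≡ w
  encode-injective {v} {w} e = trans (sym (decode-encode v)) (trans (cong decode e) (decode-encode w))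

  decode-injective : ∀ {x y} → decode x ≡ decode y → x ≡ y
  decode-injective {x} {y} e = trans (sym (encode-decode x)) (trans (cong encode e) (encode-decode y))

  ladder-graph : Graph (s + (t + ℓ))
  ladder-graph = record { Adj = λ x y → decode x ∼ decode y ; sym = ∼-sym ; irrefl = ∼-irrefl }

  decode-cycle : ∀ {C} → IsCycle ladder-graph C → IsCycleOf _∼_ (map decode C)
  decode-cycle = IsCycleOf-map decode decode-injective id

  encode-cycle : ∀ {C} → IsCycleOf _∼_ C → IsCycle ladder-graph (map encode C)
  encode-cycle = IsCycleOf-map encode encode-injective
    (λ {v} {w} v∼w → subst₂ _∼_ (sym (decode-encode v)) (sym (decode-encode w)) v∼w)

-- Counting along a rail

module _ {k : ℕ} where

  below : List (Fin k) → ℕ → ℕ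
  below [] n = 0
  below (q ∷ Y) n with toℕ q <? n
  ... | yes _ = suc (below Y n)
  ... | no _ = below Y n

  below-mono : ∀ Y {a b} → a ≤ b → below Y a ≤ below Y b
  below-mono [] _ = z≤n
  below-mono (q ∷ Y) {a} {b} a≤b with toℕ q <? a | toℕ q <? b
  ... | yes _ | yes _ = s≤s (below-mono Y a≤b)
  ... | yes q<a | no q≮b = ⊥-elim (q≮b (<-≤-trans q<a a≤b))
  ... | no _ | yes _ = m≤n⇒m≤1+n (below-mono Y a≤b)
  ... | no _ | no _ = below-mono Y a≤b

  below≤length : ∀ Y n → below Y n ≤ length Y
  below≤length [] n = z≤n
  below≤length (q ∷ Y) n with toℕ q <? n
  ... | yes _ = s≤s (below≤length Y n)
  ... | no _ = m≤n⇒m≤1+n (below≤length Y n)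

  below-suc-∈ : ∀ Y {i} → i ∈ Y → below Y (toℕ i) < below Y (suc (toℕ i))
  below-suc-∈ (q ∷ Y) {i} (here refl) with toℕ i <? suc (toℕ i) | toℕ i <? toℕ i
  ... | yes _ | no _ = s≤s (below-mono Y (n≤1+n _))
  ... | no i≮1+i | _ = ⊥-elim (i≮1+i ≤-refl)
  ... | yes _ | yes i<i = ⊥-elim (<-irrefl refl i<i)
  below-suc-∈ (q ∷ Y) {i} (there m) with toℕ q <? toℕ i | toℕ q <? suc (toℕ i)
  ... | yes _ | yes _ = s≤s (below-suc-∈ Y m)
  ... | no _ | yes _ = m≤n⇒m≤1+n (below-suc-∈ Y m)
  ... | no _ | no _ = below-suc-∈ Y m
  ... | yes q<i | no q≮1+i = ⊥-elim (q≮1+i (m≤n⇒m≤1+n q<i))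

  Between : Fin k → Fin k → Fin k → Set
  Between i i′ q = toℕ i ≤ toℕ q × toℕ q ≤ toℕ i′

  successor : (i i′ : Fin k) → toℕ i < toℕ i′ → Fin k
  successor i i′ i<i′ = fromℕ< (≤-<-trans i<i′ (toℕ<n i′))

  ascending-walk : ∀ d {i i′ : Fin k} → toℕ i′ ≡ d + toℕ i →
    ∃[ π ] (Walk Neighbours i i′ π × Unique π × All (Between i i′) π)
  ascending-walk zero e with toℕ-injective e
  ... | refl = [ _ ] , end , Unique-cons (λ ()) [] , (≤-refl , ≤-refl) ∷ []
  ascending-walk (suc d) {i} {i′} e = extend (ascending-walk d {next} {i′} e′)
    where
    i<i′ : toℕ i < toℕ i′
    i<i′ = subst (toℕ i <_) (sym e) (s≤s (m≤n+m (toℕ i) d))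
    next = successor i i′ i<i′
    next≡ : toℕ next ≡ suc (toℕ i)
    next≡ = toℕ-fromℕ< _
    e′ : toℕ i′ ≡ d + toℕ next
    e′ = trans e (trans (sym (+-suc d (toℕ i))) (cong (d +_) (sym next≡)))
    extend : ∃[ π ] (Walk Neighbours next i′ π × Unique π × All (Between next i′) π) →
      ∃[ π ] (Walk Neighbours i i′ π × Unique π × All (Between i i′) π)
    extend (π , walk , u , between) =
      i ∷ π , step (inj₁ next≡) walk , Unique-cons i∉π u , (≤-refl , <⇒≤ i<i′) ∷ All.map widen between
      where
      widen : ∀ {q} → Between next i′ q → Between i i′ q
      widen (next≤q , q≤i′) = ≤-trans (n≤1+n _) (subst (_≤ _) next≡ next≤q) , q≤i′
      i∉π : i ∉ π
      i∉π m = n≮n _ (subst (_≤ toℕ i) next≡ (proj₁ (All.lookup between m)))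

  level-between : ∀ Y {i i′ q} → below Y (toℕ i) ≡ below Y (toℕ i′) → i′ ∉ Y → Between i i′ q →
    q ∉ Y × below Y (toℕ q) ≡ below Y (toℕ i)
  level-between Y {i} {i′} {q} same i′∉ (i≤q , q≤i′) = q∉ , level
    where
    below-i′≤below-q : below Y (toℕ i′) ≤ below Y (toℕ q)
    below-i′≤below-q = ≤-trans (≤-reflexive (sym same)) (below-mono Y i≤q)
    level : below Y (toℕ q) ≡ below Y (toℕ i)
    level = ≤-antisym (≤-trans (below-mono Y q≤i′) (≤-reflexive (sym same))) (below-mono Y i≤q)
    q∉ : q ∉ Y
    q∉ q∈ = <-irrefl refl (<-≤-trans (<-≤-trans (below-suc-∈ Y q∈) (below-mono Y q<i′)) below-i′≤below-q)
      where
      q<i′ : toℕ q < toℕ i′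
      q<i′ = ≤∧≢⇒< q≤i′ (λ e → i′∉ (subst (_∈ Y) (toℕ-injective e) q∈))

  LevelWalk : List (Fin k) → Fin k → Fin k → Set
  LevelWalk Y i i′ =
    ∃[ π ] (Walk Neighbours i i′ π × Unique π × All (λ q → q ∉ Y × below Y (toℕ q) ≡ below Y (toℕ i)) π)

  level-walk : ∀ Y {i i′} → i ∉ Y → i′ ∉ Y → below Y (toℕ i) ≡ below Y (toℕ i′) → LevelWalk Y i i′
  level-walk Y {i} {i′} i∉ i′∉ same with ≤-total (toℕ i) (toℕ i′)
  ... | inj₁ i≤i′ with ascending-walk (toℕ i′ ∸ toℕ i) (sym (m∸n+n≡m i≤i′))
  ...   | π , walk , u , between = π , walk , u , All.map (level-between Y same i′∉) between
  level-walk Y {i} {i′} i∉ i′∉ same | inj₂ i′≤i with ascending-walk (toℕ i ∸ toℕ i′) (sym (m∸n+n≡m i′≤i))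
  ...   | π , walk , u , between = reverse π , Walk-reverse Neighbours-sym walk , Unique-reverse π u ,
          All.tabulate (λ m → level-from-i′ (level-between Y (sym same) i∉ (All.lookup between (reverse⁻ m))))
    where
    level-from-i′ : ∀ {q} → q ∉ Y × below Y (toℕ q) ≡ below Y (toℕ i′) →
      q ∉ Y × below Y (toℕ q) ≡ below Y (toℕ i)
    level-from-i′ (q∉ , e) = q∉ , trans e (sym same)

-- A cycle avoiding a small set of vertices

3*n+2≡2+n+n+n : ∀ n → 3 * n + 2 ≡ 2 + n + n + n
3*n+2≡2+n+n+n = solve-∀

module CycleAvoiding (s t ℓ : ℕ) (at₁ : Fin ℓ → Fin s) (at₂ : Fin ℓ → Fin t)
  (at₁-injective : ∀ {i j} → at₁ i ≡ at₁ j → i ≡ j)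
  (at₂-injective : ∀ {i j} → at₂ i ≡ at₂ j → i ≡ j) where

  open Ladder s t ℓ at₁ at₂

  rail₁-positions : List Vertex → List (Fin s)
  rail₁-positions [] = []
  rail₁-positions (rail₁ i ∷ X) = i ∷ rail₁-positions X
  rail₁-positions (rail₂ _ ∷ X) = rail₁-positions X
  rail₁-positions (rung _ ∷ X) = rail₁-positions X

  rail₂-positions : List Vertex → List (Fin t)
  rail₂-positions [] = []
  rail₂-positions (rail₁ _ ∷ X) = rail₂-positions X
  rail₂-positions (rail₂ i ∷ X) = i ∷ rail₂-positions X
  rail₂-positions (rung _ ∷ X) = rail₂-positions X

  length-rail₁-positions : ∀ X → length (rail₁-positions X) ≤ length X
  length-rail₁-positions [] = z≤n
  length-rail₁-positions (rail₁ _ ∷ X) = s≤s (length-rail₁-positions X)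
  length-rail₁-positions (rail₂ _ ∷ X) = m≤n⇒m≤1+n (length-rail₁-positions X)
  length-rail₁-positions (rung _ ∷ X) = m≤n⇒m≤1+n (length-rail₁-positions X)

  length-rail₂-positions : ∀ X → length (rail₂-positions X) ≤ length X
  length-rail₂-positions [] = z≤n
  length-rail₂-positions (rail₁ _ ∷ X) = m≤n⇒m≤1+n (length-rail₂-positions X)
  length-rail₂-positions (rail₂ _ ∷ X) = s≤s (length-rail₂-positions X)
  length-rail₂-positions (rung _ ∷ X) = m≤n⇒m≤1+n (length-rail₂-positions X)

  ∈-rail₁-positions⁺ : ∀ {X i} → rail₁ i ∈ X → i ∈ rail₁-positions X
  ∈-rail₁-positions⁺ {rail₁ _ ∷ X} (here refl) = here refl
  ∈-rail₁-positions⁺ {rail₁ _ ∷ X} (there m) = there (∈-rail₁-positions⁺ m)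
  ∈-rail₁-positions⁺ {rail₂ _ ∷ X} (there m) = ∈-rail₁-positions⁺ m
  ∈-rail₁-positions⁺ {rung _ ∷ X} (there m) = ∈-rail₁-positions⁺ m

  ∈-rail₂-positions⁺ : ∀ {X i} → rail₂ i ∈ X → i ∈ rail₂-positions X
  ∈-rail₂-positions⁺ {rail₂ _ ∷ X} (here refl) = here refl
  ∈-rail₂-positions⁺ {rail₂ _ ∷ X} (there m) = there (∈-rail₂-positions⁺ m)
  ∈-rail₂-positions⁺ {rail₁ _ ∷ X} (there m) = ∈-rail₂-positions⁺ m
  ∈-rail₂-positions⁺ {rung _ ∷ X} (there m) = ∈-rail₂-positions⁺ m

  ∈-rail₁-positions⁻ : ∀ {X i} → i ∈ rail₁-positions X → rail₁ i ∈ X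
  ∈-rail₁-positions⁻ {rail₁ _ ∷ X} (here refl) = here refl
  ∈-rail₁-positions⁻ {rail₁ _ ∷ X} (there m) = there (∈-rail₁-positions⁻ m)
  ∈-rail₁-positions⁻ {rail₂ _ ∷ X} m = there (∈-rail₁-positions⁻ m)
  ∈-rail₁-positions⁻ {rung _ ∷ X} m = there (∈-rail₁-positions⁻ m)

  ∈-rail₂-positions⁻ : ∀ {X i} → i ∈ rail₂-positions X → rail₂ i ∈ X
  ∈-rail₂-positions⁻ {rail₂ _ ∷ X} (here refl) = here refl
  ∈-rail₂-positions⁻ {rail₂ _ ∷ X} (there m) = there (∈-rail₂-positions⁻ m)
  ∈-rail₂-positions⁻ {rail₁ _ ∷ X} m = there (∈-rail₂-positions⁻ m)
  ∈-rail₂-positions⁻ {rung _ ∷ X} m = there (∈-rail₂-positions⁻ m)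

  Hits : Vertex → Fin ℓ → Set
  Hits x j = x ≡ rung j ⊎ x ≡ end₁ j ⊎ x ≡ end₂ j

  hits? : ∀ x j → Dec (Hits x j)
  hits? x j = x ≟ rung j ⊎-dec x ≟ end₁ j ⊎-dec x ≟ end₂ j

  hits-unique : ∀ {x j j′} → Hits x j → Hits x j′ → j ≡ j′
  hits-unique (inj₁ refl) (inj₁ e) = rung-injective e
  hits-unique (inj₂ (inj₁ refl)) (inj₂ (inj₁ e)) = at₁-injective (rail₁-injective e)
  hits-unique (inj₂ (inj₂ refl)) (inj₂ (inj₂ e)) = at₂-injective (rail₂-injective e)
  hits-unique (inj₁ refl) (inj₂ (inj₁ ()))
  hits-unique (inj₁ refl) (inj₂ (inj₂ ()))
  hits-unique (inj₂ (inj₁ refl)) (inj₁ ())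
  hits-unique (inj₂ (inj₁ refl)) (inj₂ (inj₂ ()))
  hits-unique (inj₂ (inj₂ refl)) (inj₁ ())
  hits-unique (inj₂ (inj₂ refl)) (inj₂ (inj₁ ()))

  survivors : List Vertex → List (Fin ℓ)
  survivors [] = allFin ℓ
  survivors (x ∷ X) = filter (λ j → ¬? (hits? x j)) (survivors X)

  survivors-unique : ∀ X → Unique (survivors X)
  survivors-unique [] = allFin⁺ ℓ
  survivors-unique (x ∷ X) = filter⁺ (λ j → ¬? (hits? x j)) (survivors-unique X)

  survivor-avoids : ∀ X {j} → j ∈ survivors X → All (λ x → ¬ Hits x j) X
  survivor-avoids [] _ = []
  survivor-avoids (x ∷ X) m with ∈-filter⁻ (λ j → ¬? (hits? x j)) m
  ... | m′ , ¬hit = ¬hit ∷ survivor-avoids X m′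

  many-survivors : ∀ X → ℓ ≤ length (survivors X) + length X
  many-survivors [] = subst (ℓ ≤_) (sym (trans (+-identityʳ _) (length-tabulate (λ i → i)))) ≤-refl
  many-survivors (x ∷ X) = ≤-trans (many-survivors X) (subst (length (survivors X) + length X ≤_) (sym (+-suc _ (length X)))
    (+-monoˡ-≤ (length X) (filter-removes-at-most-one (hits? x) (survivors-unique X) (λ _ _ → hits-unique))))

  relabel : Fin ℓ → ℕ → ℕ → (Vertex → ℕ) → Vertex → ℕ
  relabel j α β label x with x ≟ rung j | label x ≟ℕ β
  ... | yes _ | _ = α
  ... | no _ | yes _ = α
  ... | no _ | no _ = label x

  relabel-rung : ∀ j α β label → relabel j α β label (rung j) ≡ α
  relabel-rung j α β label with rung j ≟ rung j
  ... | yes _ = refl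
  ... | no r≢r = ⊥-elim (r≢r refl)

  relabel-merged : ∀ j α β label {x} → label x ≡ β → relabel j α β label x ≡ α
  relabel-merged j α β label {x} e with x ≟ rung j | label x ≟ℕ β
  ... | yes _ | _ = refl
  ... | no _ | yes _ = refl
  ... | no _ | no ≢β = ⊥-elim (≢β e)

  relabel-other : ∀ j α β label {x} → x ≢ rung j → label x ≢ β → relabel j α β label x ≡ label x
  relabel-other j α β label {x} x≢r ≢β with x ≟ rung j | label x ≟ℕ β
  ... | yes e | _ = ⊥-elim (x≢r e)
  ... | no _ | yes e = ⊥-elim (≢β e)
  ... | no _ | no _ = refl

  OnRail⇒≢rung : ∀ {w j} → OnRail w → w ≢ rung j
  OnRail⇒≢rung w-on = rung≢OnRail w-on ∘ sym

  module _ (X : List Vertex) where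

    ∣X∣ = length X
    Y₁ = rail₁-positions X
    Y₂ = rail₂-positions X

    -- A rail vertex is labelled by the component of its rail minus X containing it, numbered by the
    -- number of vertices of X below it; the labels of the second rail come after those of the first.
    label₀ : Vertex → ℕ
    label₀ (rail₁ i) = below Y₁ (toℕ i)
    label₀ (rail₂ i) = suc (∣X∣ + below Y₂ (toℕ i))
    label₀ (rung _) = 0

    Joined : List (Fin ℓ) → (Vertex → ℕ) → Vertex → Vertex → Set
    Joined rem label w w′ = ∃[ π ] (Walk _∼_ w w′ π × Unique π ×
      All (λ x → x ∉ X × label x ≡ label w) π × (∀ {j} → j ∈ rem → rung j ∉ π))

    -- rem are the rungs still to be processed. Processing a rung whose ends carry different labels merges
    -- the two labels; since there are never more labels than rungs left, some rung closes a cycle.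
    record Invariant (rem : List (Fin ℓ)) (label : Vertex → ℕ) (labels : List ℕ) : Set where
      field
        rem-unique : Unique rem
        rem-avoids : ∀ {j} → j ∈ rem → rung j ∉ X × end₁ j ∉ X × end₂ j ∉ X
        label∈ : ∀ {w} → OnRail w → w ∉ X → label w ∈ labels
        joined : ∀ {w w′} → OnRail w → OnRail w′ → w ∉ X → w′ ∉ X → label w ≡ label w′ →
          Joined rem label w w′

    AvoidingCycle : Set
    AvoidingCycle = ∃[ C ] (IsCycleOf _∼_ C × All (_∉ X) C)

    lift-level-walk : ∀ {k rem} (embed : Fin k → Vertex) (Y : List (Fin k)) →
      (∀ {i i′} → embed i ≡ embed i′ → i ≡ i′) → (∀ {i i′} → Neighbours i i′ → embed i ∼ embed i′) →
      (∀ {j i} → rung j ≢ embed i) → (∀ {i} → i ∉ Y → embed i ∉ X) →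
      (∀ {i i′} → below Y (toℕ i) ≡ below Y (toℕ i′) → label₀ (embed i) ≡ label₀ (embed i′)) →
      ∀ {i i′} → LevelWalk Y i i′ → Joined rem label₀ (embed i) (embed i′)
    lift-level-walk embed Y injective hom not-rung avoids level (π , walk , u , levels) =
      map embed π , Walk-map embed hom walk , Unique-map⁺ injective u ,
      All-map⁺ (All.map (λ (q∉ , e) → avoids q∉ , level e) levels) ,
      λ _ r∈ → case ∈-map⁻ embed r∈ of λ (_ , _ , e) → not-rung e

    label₀-rail₁≤∣X∣ : ∀ i → label₀ (rail₁ i) ≤ ∣X∣
    label₀-rail₁≤∣X∣ i = ≤-trans (below≤length Y₁ (toℕ i)) (length-rail₁-positions X)

    label₀-rail₂≤ : ∀ i → label₀ (rail₂ i) ≤ suc (∣X∣ + ∣X∣)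
    label₀-rail₂≤ i = s≤s (+-monoʳ-≤ ∣X∣ (≤-trans (below≤length Y₂ (toℕ i)) (length-rail₂-positions X)))

    initial-joined : ∀ {rem w w′} → OnRail w → OnRail w′ → w ∉ X → w′ ∉ X → label₀ w ≡ label₀ w′ →
      Joined rem label₀ w w′
    initial-joined {w = rail₁ i} {rail₁ i′} _ _ w∉ w′∉ e =
      lift-level-walk rail₁ Y₁ rail₁-injective id (λ ()) (λ q∉ → q∉ ∘ ∈-rail₁-positions⁺) id
        (level-walk Y₁ (w∉ ∘ ∈-rail₁-positions⁻) (w′∉ ∘ ∈-rail₁-positions⁻) e)
    initial-joined {w = rail₂ i} {rail₂ i′} _ _ w∉ w′∉ e =
      lift-level-walk rail₂ Y₂ rail₂-injective id (λ ()) (λ q∉ → q∉ ∘ ∈-rail₂-positions⁺)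
        (cong (suc ∘ (∣X∣ +_)))
        (level-walk Y₂ (w∉ ∘ ∈-rail₂-positions⁻) (w′∉ ∘ ∈-rail₂-positions⁻)
          (+-cancelˡ-≡ ∣X∣ _ _ (suc-injective e)))
    initial-joined {w = rail₁ i} {rail₂ _} _ _ _ _ e =
      ⊥-elim (n≮n ∣X∣ (≤-trans (s≤s (m≤m+n ∣X∣ _)) (subst (_≤ ∣X∣) e (label₀-rail₁≤∣X∣ i))))
    initial-joined {w = rail₂ _} {rail₁ i′} _ _ _ _ e =
      ⊥-elim (n≮n ∣X∣ (≤-trans (s≤s (m≤m+n ∣X∣ _)) (subst (_≤ ∣X∣) (sym e) (label₀-rail₁≤∣X∣ i′))))

    labels₀ : List ℕ
    labels₀ = upTo (2 + ∣X∣ + ∣X∣)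

    initial : Invariant (survivors X) label₀ labels₀
    initial = record
      { rem-unique = survivors-unique X
      ; rem-avoids = λ m → let avoid = survivor-avoids X m in
          (λ r∈ → All.lookup avoid r∈ (inj₁ refl)) , (λ e∈ → All.lookup avoid e∈ (inj₂ (inj₁ refl))) ,
          (λ e∈ → All.lookup avoid e∈ (inj₂ (inj₂ refl)))
      ; label∈ = label∈₀
      ; joined = initial-joined
      }
      where
      label∈₀ : ∀ {w} → OnRail w → w ∉ X → label₀ w ∈ labels₀
      label∈₀ {rail₁ i} _ _ =
        ∈-upTo⁺ (s≤s (≤-trans (label₀-rail₁≤∣X∣ i) (≤-trans (m≤m+n ∣X∣ ∣X∣) (n≤1+n _))))
      label∈₀ {rail₂ i} _ _ = ∈-upTo⁺ (s≤s (label₀-rail₂≤ i))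

    Joined-sym : ∀ {rem label w w′} → label w ≡ label w′ → Joined rem label w w′ → Joined rem label w′ w
    Joined-sym same (π , walk , u , avoid , no-rung) =
      reverse π , Walk-reverse ∼-sym walk , Unique-reverse π u ,
      All.tabulate (λ m → map₂ (λ e → trans e same) (All.lookup avoid (reverse⁻ m))) ,
      λ j∈ r∈ → no-rung j∈ (reverse⁻ r∈)

    Via : (Vertex → ℕ) → Fin ℓ → Vertex → Vertex → Vertex → Set
    Via label j w v x = x ≡ rung j ⊎ (x ≢ rung j × (label x ≡ label w ⊎ label x ≡ label v))

    JoinedVia : List (Fin ℓ) → (Vertex → ℕ) → Fin ℓ → Vertex → Vertex → Vertex → Set
    JoinedVia rem label j w v w′ = ∃[ π ] (Walk _∼_ w w′ π × Unique π ×
      All (λ x → x ∉ X × Via label j w v x) π × (∀ {j′} → j′ ∈ rem → rung j′ ∉ π))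

    join-through-rung : ∀ {rem j label w u v w′} → j ∉ rem → rung j ∉ X → u ∼ rung j → rung j ∼ v →
      label w ≢ label v → Joined (j ∷ rem) label w u → Joined (j ∷ rem) label v w′ → JoinedVia rem label j w v w′
    join-through-rung {rem} {j} {label} {w} {v = v} j∉rem r∉X u∼ ∼v w≢v
      (π₁ , walk₁ , u₁ , avoid₁ , no-rung₁) (π₂ , walk₂ , u₂ , avoid₂ , no-rung₂) =
      π₁ ++ rung j ∷ π₂ , Walk-join walk₁ u∼ (step ∼v walk₂) ,
      Unique-++⁺ u₁ (Unique-cons (no-rung₂ (here refl)) u₂) disjoint ,
      All-++⁺ (All.tabulate first) ((r∉X , inj₁ refl) ∷ All.tabulate second) ,
      no-rung
      where
      first : ∀ {x} → x ∈ π₁ → x ∉ X × Via label j w v x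
      first m = proj₁ (All.lookup avoid₁ m) ,
        inj₂ ((λ { refl → no-rung₁ (here refl) m }) , inj₁ (proj₂ (All.lookup avoid₁ m)))
      second : ∀ {x} → x ∈ π₂ → x ∉ X × Via label j w v x
      second m = proj₁ (All.lookup avoid₂ m) ,
        inj₂ ((λ { refl → no-rung₂ (here refl) m }) , inj₂ (proj₂ (All.lookup avoid₂ m)))
      disjoint : ∀ {x} → x ∈ π₁ → x ∉ rung j ∷ π₂
      disjoint m (here refl) = no-rung₁ (here refl) m
      disjoint m (there m′) = w≢v (trans (sym (proj₂ (All.lookup avoid₁ m))) (proj₂ (All.lookup avoid₂ m′)))
      no-rung : ∀ {j′} → j′ ∈ rem → rung j′ ∉ π₁ ++ rung j ∷ π₂
      no-rung j′∈ r∈ with ∈-++⁻ π₁ r∈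
      ... | inj₁ m = no-rung₁ (there j′∈) m
      ... | inj₂ (here e) = j∉rem (subst (_∈ rem) (rung-injective e) j′∈)
      ... | inj₂ (there m) = no-rung₂ (there j′∈) m

    module Merge {j rem label labels} (inv : Invariant (j ∷ rem) label labels)
      (α≢β : label (end₁ j) ≢ label (end₂ j)) where

      open Invariant inv

      α = label (end₁ j)
      β = label (end₂ j)

      label′ : Vertex → ℕ
      label′ = relabel j α β label

      labels′ : List ℕ
      labels′ = filter (λ z → ¬? (z ≟ℕ β)) labels

      j∉rem : j ∉ rem
      j∉rem = Unique[x∷xs]⇒x∉xs rem-unique

      r∉X : rung j ∉ X
      r∉X = proj₁ (rem-avoids (here refl))

      e₁∉X : end₁ j ∉ X
      e₁∉X = proj₁ (proj₂ (rem-avoids (here refl)))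

      e₂∉X : end₂ j ∉ X
      e₂∉X = proj₂ (proj₂ (rem-avoids (here refl)))

      α∈labels′ : α ∈ labels′
      α∈labels′ = ∈-filter⁺ (λ z → ¬? (z ≟ℕ β)) (label∈ tt e₁∉X) α≢β

      labels′-shorter : length labels′ < length labels
      labels′-shorter =
        filter-notAll (λ z → ¬? (z ≟ℕ β)) labels (Any.map (λ β≡z z≢β → z≢β (sym β≡z)) (label∈ tt e₂∉X))

      label∈′ : ∀ {w} → OnRail w → w ∉ X → label′ w ∈ labels′
      label∈′ {w} w-on w∉ = case label w ≟ℕ β of λ where
        (yes w-β) → subst (_∈ labels′) (sym (relabel-merged j α β label w-β)) α∈labels′
        (no w-¬β) → subst (_∈ labels′) (sym (relabel-other j α β label (OnRail⇒≢rung w-on) w-¬β))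
                      (∈-filter⁺ (λ z → ¬? (z ≟ℕ β)) (label∈ w-on w∉) w-¬β)

      drop-rung : ∀ {π} → (∀ {j′} → j′ ∈ j ∷ rem → rung j′ ∉ π) → ∀ {j′} → j′ ∈ rem → rung j′ ∉ π
      drop-rung no-rung = no-rung ∘ there

      joined-merged : ∀ {w w′} → OnRail w → OnRail w′ → w ∉ X → w′ ∉ X → label w ≡ β → label w′ ≡ β →
        Joined rem label′ w w′
      joined-merged w-on w′-on w∉ w′∉ w-β w′-β with joined w-on w′-on w∉ w′∉ (trans w-β (sym w′-β))
      ... | π , walk , u , avoid , no-rung = π , walk , u ,
            All.map (λ (x∉ , e) → x∉ , trans (relabel-merged j α β label (trans e w-β))
                                             (sym (relabel-merged j α β label w-β))) avoid ,
            drop-rung no-rung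

      joined-unmerged : ∀ {w w′} → OnRail w → OnRail w′ → w ∉ X → w′ ∉ X → label w ≢ β → label w′ ≢ β →
        label′ w ≡ label′ w′ → Joined rem label′ w w′
      joined-unmerged {w} w-on w′-on w∉ w′∉ w-¬β w′-¬β e
        with joined w-on w′-on w∉ w′∉ (trans (sym (relabel-other j α β label (OnRail⇒≢rung w-on) w-¬β))
               (trans e (relabel-other j α β label (OnRail⇒≢rung w′-on) w′-¬β)))
      ... | π , walk , u , avoid , no-rung = π , walk , u , All.tabulate unchanged , drop-rung no-rung
        where
        unchanged : ∀ {x} → x ∈ π → x ∉ X × label′ x ≡ label′ w
        unchanged m with All.lookup avoid m
        ... | x∉ , x≡w = x∉ ,
          trans (relabel-other j α β label (λ { refl → no-rung (here refl) m }) (λ x-β → w-¬β (trans (sym x≡w) x-β)))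
                          (trans x≡w (sym (relabel-other j α β label (OnRail⇒≢rung w-on) w-¬β)))

      joined-across : ∀ {w w′} → OnRail w → OnRail w′ → w ∉ X → w′ ∉ X → label w ≡ β → label w′ ≢ β →
        label′ w ≡ label′ w′ → Joined rem label′ w w′
      joined-across {w} {w′} w-on w′-on w∉ w′∉ w-β w′-¬β e =
        relabelled (join-through-rung j∉rem r∉X refl refl (λ β≡α → α≢β (sym (trans (sym w-β) β≡α)))
          (joined w-on tt w∉ e₂∉X w-β) (joined tt w′-on e₁∉X w′∉ (sym w′-α)))
        where
        w′-α : label w′ ≡ α
        w′-α = trans (sym (relabel-other j α β label (OnRail⇒≢rung w′-on) w′-¬β))
                 (trans (sym e) (relabel-merged j α β label w-β))
        to-α : ∀ {x} → Via label j w (end₁ j) x → label′ x ≡ α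
        to-α (inj₁ refl) = relabel-rung j α β label
        to-α (inj₂ (_ , inj₁ x≡w)) = relabel-merged j α β label (trans x≡w w-β)
        to-α (inj₂ (x≢r , inj₂ x-α)) =
          trans (relabel-other j α β label x≢r (λ x-β → α≢β (trans (sym x-α) x-β))) x-α
        relabelled : JoinedVia rem label j w (end₁ j) w′ → Joined rem label′ w w′
        relabelled (π , walk , u , avoid , no-rung) =
          π , walk , u , All.map (λ (x∉ , via) → x∉ , trans (to-α via) (sym (relabel-merged j α β label w-β))) avoid , no-rung

      joined′ : ∀ {w w′} → OnRail w → OnRail w′ → w ∉ X → w′ ∉ X → label′ w ≡ label′ w′ →
        Joined rem label′ w w′
      joined′ {w} {w′} w-on w′-on w∉ w′∉ e = case label w ≟ℕ β of λ where
        (yes w-β) → case label w′ ≟ℕ β of λ where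
          (yes w′-β) → joined-merged w-on w′-on w∉ w′∉ w-β w′-β
          (no w′-¬β) → joined-across w-on w′-on w∉ w′∉ w-β w′-¬β e
        (no w-¬β) → case label w′ ≟ℕ β of λ where
          (yes w′-β) → Joined-sym (sym e) (joined-across w′-on w-on w′∉ w∉ w′-β w-¬β (sym e))
          (no w′-¬β) → joined-unmerged w-on w′-on w∉ w′∉ w-¬β w′-¬β e

      invariant′ : Invariant rem label′ labels′
      invariant′ = record
        { rem-unique = Unique-tail rem-unique ; rem-avoids = rem-avoids ∘ there ; label∈ = label∈′ ; joined = joined′ }

    close-cycle : ∀ {j rem label labels} → Invariant (j ∷ rem) label labels → label (end₁ j) ≡ label (end₂ j) →
      AvoidingCycle
    close-cycle {j} inv same with Invariant.rem-avoids inv (here refl)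
    ... | r∉X , e₁∉X , e₂∉X with Invariant.joined inv tt tt e₂∉X e₁∉X (sym same)
    ... | π , walk , u , avoid , no-rung =
      rung j ∷ π ,
      (s≤s (2≤length-Walk walk (λ ())) , Unique-cons (no-rung (here refl)) u , Walk⇒Linked (step refl (Walk-join walk refl end))) ,
      r∉X ∷ All.map proj₁ avoid

    find-cycle : ∀ rem label labels → Invariant rem label labels → 1 ≤ length labels → length labels ≤ length rem →
      AvoidingCycle
    find-cycle [] label labels inv 1≤ ≤0 = ⊥-elim (n≮n 0 (≤-trans 1≤ ≤0))
    find-cycle (j ∷ rem) label labels inv 1≤ ≤rem with label (end₁ j) ≟ℕ label (end₂ j)
    ... | yes same = close-cycle inv same
    ... | no α≢β =
      find-cycle rem label′ labels′ invariant′ (∈-length α∈labels′) (≤-pred (≤-trans labels′-shorter ≤rem))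
      where open Merge inv α≢β

    avoiding-cycle : 3 * ∣X∣ + 2 ≤ ℓ → AvoidingCycle
    avoiding-cycle 3∣X∣+2≤ℓ = find-cycle (survivors X) label₀ labels₀ initial
      (subst (1 ≤_) (sym (length-upTo (2 + ∣X∣ + ∣X∣))) (s≤s z≤n)) enough
      where
      count : 3 * ∣X∣ + 2 ≡ length labels₀ + ∣X∣
      count = trans (3*n+2≡2+n+n+n ∣X∣) (cong (_+ ∣X∣) (sym (length-upTo (2 + ∣X∣ + ∣X∣))))
      enough : length labels₀ ≤ length (survivors X)
      enough = +-cancelʳ-≤ ∣X∣ _ _ (≤-trans (subst (_≤ ℓ) count 3∣X∣+2≤ℓ) (many-survivors X))

  no-small-feedback-vertex-set : ∀ X → FeedbackVertexSet ladder-graph X → 3 * length X + 2 ≤ ℓ → ⊥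
  no-small-feedback-vertex-set X hitting small
    with avoiding-cycle (map decode X) (subst (λ m → 3 * m + 2 ≤ ℓ) (sym (length-map decode X)) small)
  ... | C , cycle , avoids with hitting (map encode C) (encode-cycle cycle)
  ... | x , x∈X , x∈C with ∈-map⁻ encode x∈C
  ... | v , v∈C , refl = All.lookup avoids v∈C (subst (_∈ map decode X) (decode-encode v) (∈-map⁺ decode x∈X))

-- Lifting ladder cycles to H

lookup-injective : ∀ {A : Set} (xs : List A) → Unique xs → ∀ {i j} → lookup xs i ≡ lookup xs j → i ≡ j
lookup-injective (x ∷ xs) u {fzero} {fzero} e = refl
lookup-injective (x ∷ xs) u {fzero} {fsuc j} e = ⊥-elim (Unique[x∷xs]⇒x∉xs u (subst (_∈ xs) (sym e) (∈-lookup j)))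
lookup-injective (x ∷ xs) u {fsuc i} {fzero} e = ⊥-elim (Unique[x∷xs]⇒x∉xs u (subst (_∈ xs) e (∈-lookup i)))
lookup-injective (x ∷ xs) u {fsuc i} {fsuc j} e = cong fsuc (lookup-injective xs (Unique-tail u) e)

consecutive-lookup : ∀ {A : Set} (xs : List A) {i j : Fin (length xs)} → toℕ j ≡ suc (toℕ i) →
  Consecutive (lookup xs i) (lookup xs j) xs
consecutive-lookup (x ∷ y ∷ xs) {fzero} {fsuc fzero} _ = here
consecutive-lookup (x ∷ xs) {fsuc i} {fsuc j} e = there (consecutive-lookup xs (suc-injective e))

Consecutive⇒Consec : ∀ {n} {u v : Fin n} {xs} → Consecutive u v xs → Consec u v xs
Consecutive⇒Consec here = here
Consecutive⇒Consec (there c) = there (Consecutive⇒Consec c)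

Consec⇒Consecutive : ∀ {n} {u v : Fin n} {xs} → Consec u v xs → Consecutive u v xs
Consec⇒Consecutive here = here
Consec⇒Consecutive (there c) = there (Consec⇒Consecutive c)

PathEdge-sym : ∀ {n} {xs : List (Fin n)} {u v} → PathEdge xs u v → PathEdge xs v u
PathEdge-sym (inj₁ c) = inj₂ c
PathEdge-sym (inj₂ c) = inj₁ c

module Lifting {n : ℕ} (G : Graph n) (P₁ P₂ : List (Fin n)) (P₁-path : IsPath G P₁) (P₂-path : IsPath G P₂)
  (P₁∩P₂=∅ : Disjoint P₁ P₂) (ℓ : ℕ) (Q : Fin ℓ → List (Fin n)) (Q-path : ∀ j → IsPath G (Q j))
  (Q-disjoint : ∀ i j → i ≢ j → Disjoint (Q i) (Q j)) (Q-connects : ∀ j → Connects P₁ P₂ (Q j)) where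

  record Oriented (j : Fin ℓ) : Set where
    field
      start finish : Fin n
      interior : List (Fin n)
      start∈P₁ : start ∈ P₁
      finish∈P₂ : finish ∈ P₂
      orientation : Q j ≡ start ∷ interior ∷ʳ finish ⊎ Q j ≡ reverse (start ∷ interior ∷ʳ finish)
      interior-avoids : ∀ v → v ∈ interior → v ∉ P₁ × v ∉ P₂

  oriented : ∀ j → Oriented j
  oriented j with Q-connects j
  ... | a , b , I , eq , inj₁ (a∈ , b∈) , avoids = record
    { start = a ; finish = b ; interior = I ; start∈P₁ = a∈ ; finish∈P₂ = b∈ ; orientation = inj₁ eq
    ; interior-avoids = avoids }
  ... | a , b , I , eq , inj₂ (a∈ , b∈) , avoids = record
    { start = b ; finish = a ; interior = reverse I ; start∈P₁ = b∈ ; finish∈P₂ = a∈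
    ; orientation = inj₂ (trans eq reversed) ; interior-avoids = λ v m → avoids v (reverse⁻ m) }
    where
    reversed : a ∷ I ∷ʳ b ≡ reverse (b ∷ reverse I ∷ʳ a)
    reversed rewrite unfold-reverse b (reverse I ∷ʳ a) | reverse-++ (reverse I) [ a ] | reverse-involutive I = refl

  start finish : Fin ℓ → Fin n
  start j = Oriented.start (oriented j)
  finish j = Oriented.finish (oriented j)

  interior : Fin ℓ → List (Fin n)
  interior j = Oriented.interior (oriented j)

  forward : Fin ℓ → List (Fin n)
  forward j = start j ∷ interior j ∷ʳ finish j

  ∈-forward⁻ : ∀ j {v} → v ∈ forward j → v ∈ Q j
  ∈-forward⁻ j m with Oriented.orientation (oriented j)
  ... | inj₁ e = subst (_ ∈_) (sym e) m
  ... | inj₂ e = subst (_ ∈_) (sym e) (reverse⁺ m)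

  ∈-forward⁺ : ∀ j {v} → v ∈ Q j → v ∈ forward j
  ∈-forward⁺ j m with Oriented.orientation (oriented j)
  ... | inj₁ e = subst (_ ∈_) e m
  ... | inj₂ e = reverse⁻ (subst (_ ∈_) e m)

  consecutive-forward⁻ : ∀ j {u v} → Consecutive u v (forward j) → Consecutive u v (Q j) ⊎ Consecutive v u (Q j)
  consecutive-forward⁻ j c with Oriented.orientation (oriented j)
  ... | inj₁ e = inj₁ (subst (Consecutive _ _) (sym e) c)
  ... | inj₂ e = inj₂ (subst (Consecutive _ _) (sym e) (consecutive-reverse c))

  consecutive-forward⁺ : ∀ j {u v} → Consecutive u v (Q j) → Consecutive u v (forward j) ⊎ Consecutive v u (forward j)
  consecutive-forward⁺ j c with Oriented.orientation (oriented j)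
  ... | inj₁ e = inj₁ (subst (Consecutive _ _) e c)
  ... | inj₂ e = inj₂ (subst (Consecutive _ _) (reverse-involutive (forward j)) (consecutive-reverse (subst (Consecutive _ _) e c)))

  forward-unique : ∀ j → Unique (forward j)
  forward-unique j with Oriented.orientation (oriented j)
  ... | inj₁ e = subst Unique e (proj₁ (proj₂ (Q-path j)))
  ... | inj₂ e = subst Unique (reverse-involutive (forward j))
                   (Unique-reverse (reverse (forward j)) (subst Unique e (proj₁ (proj₂ (Q-path j)))))

  interior-unique : ∀ j → Unique (interior j)
  interior-unique j = Unique-++⁻ˡ (interior j) (Unique-tail (forward-unique j))

  start∈Q : ∀ j → start j ∈ Q j
  start∈Q j = ∈-forward⁻ j (here refl)

  finish∈Q : ∀ j → finish j ∈ Q j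
  finish∈Q j = ∈-forward⁻ j (there (∈-++⁺ʳ (interior j) (here refl)))

  interior⊆Q : ∀ j {v} → v ∈ interior j → v ∈ Q j
  interior⊆Q j m = ∈-forward⁻ j (there (∈-++⁺ˡ m))

  shared⇒same : ∀ {i j v} → v ∈ Q i → v ∈ Q j → i ≡ j
  shared⇒same {i} {j} {v} v∈Qi v∈Qj with i ≟ᶠ j
  ... | yes i≡j = i≡j
  ... | no i≢j = ⊥-elim (Q-disjoint i j i≢j v v∈Qi v∈Qj)

  EdgeH : Fin n → Fin n → Set
  EdgeH u v = Adj G u v × InH-E P₁ P₂ Q u v

  EdgeH-sym : ∀ {u v} → EdgeH u v → EdgeH v u
  EdgeH-sym (a , inj₁ e) = Graph.sym G a , inj₁ (PathEdge-sym e)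
  EdgeH-sym (a , inj₂ (inj₁ e)) = Graph.sym G a , inj₂ (inj₁ (PathEdge-sym e))
  EdgeH-sym (a , inj₂ (inj₂ (j , e))) = Graph.sym G a , inj₂ (inj₂ (j , PathEdge-sym e))

  EdgeH-P₁ : ∀ {u v} → Consecutive u v P₁ → EdgeH u v
  EdgeH-P₁ c = Linked⇒consecutive (proj₂ (proj₂ P₁-path)) c , inj₁ (inj₁ (Consecutive⇒Consec c))

  EdgeH-P₂ : ∀ {u v} → Consecutive u v P₂ → EdgeH u v
  EdgeH-P₂ c = Linked⇒consecutive (proj₂ (proj₂ P₂-path)) c , inj₂ (inj₁ (inj₁ (Consecutive⇒Consec c)))

  EdgeH-Q : ∀ j {u v} → Consecutive u v (Q j) → EdgeH u v
  EdgeH-Q j c = Linked⇒consecutive (proj₂ (proj₂ (Q-path j))) c , inj₂ (inj₂ (j , inj₁ (Consecutive⇒Consec c)))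

  EdgeH-forward : ∀ j {u v} → Consecutive u v (forward j) → EdgeH u v
  EdgeH-forward j c with consecutive-forward⁻ j c
  ... | inj₁ d = EdgeH-Q j d
  ... | inj₂ d = EdgeH-sym (EdgeH-Q j d)

  at₁ : Fin ℓ → Fin (length P₁)
  at₁ j = Any.index (Oriented.start∈P₁ (oriented j))

  at₂ : Fin ℓ → Fin (length P₂)
  at₂ j = Any.index (Oriented.finish∈P₂ (oriented j))

  lookup-at₁ : ∀ j → lookup P₁ (at₁ j) ≡ start j
  lookup-at₁ j = sym (lookup-index (Oriented.start∈P₁ (oriented j)))

  lookup-at₂ : ∀ j → lookup P₂ (at₂ j) ≡ finish j
  lookup-at₂ j = sym (lookup-index (Oriented.finish∈P₂ (oriented j)))

  at₁-injective : ∀ {i j} → at₁ i ≡ at₁ j → i ≡ j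
  at₁-injective {i} {j} e = shared⇒same (start∈Q i)
    (subst (_∈ Q j) (sym (index-injective (setoid _) (Oriented.start∈P₁ (oriented i)) (Oriented.start∈P₁ (oriented j)) e))
      (start∈Q j))

  at₂-injective : ∀ {i j} → at₂ i ≡ at₂ j → i ≡ j
  at₂-injective {i} {j} e = shared⇒same (finish∈Q i)
    (subst (_∈ Q j) (sym (index-injective (setoid _) (Oriented.finish∈P₂ (oriented i)) (Oriented.finish∈P₂ (oriented j)) e))
      (finish∈Q j))

  open Ladder (length P₁) (length P₂) ℓ at₁ at₂ public

  image : Vertex → Fin n
  image (rail₁ i) = lookup P₁ i
  image (rail₂ i) = lookup P₂ i
  image (rung j) = start j

  -- The vertices of H that a ladder vertex stands for: a rung stands for the interior of its path.
  bag : Vertex → List (Fin n)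
  bag (rail₁ i) = [ lookup P₁ i ]
  bag (rail₂ i) = [ lookup P₂ i ]
  bag (rung j) = interior j

  -- The vertices of H traversed on entering v from q (the orientation of a rung depends on q).
  block : Vertex → Vertex → List (Fin n)
  block _ (rail₁ i) = [ lookup P₁ i ]
  block _ (rail₂ i) = [ lookup P₂ i ]
  block (rail₁ _) (rung j) = interior j
  block (rail₂ _) (rung j) = reverse (interior j)
  block (rung _) (rung j) = reverse (interior j)

  blocks : Vertex → List Vertex → List (Fin n)
  blocks q [] = []
  blocks q (x ∷ xs) = block q x ++ blocks x xs

  lift : Vertex → List Vertex → List (Fin n)
  lift p W = image p ∷ blocks p W

  last-or : Vertex → List Vertex → Vertex
  last-or q [] = q
  last-or q (x ∷ xs) = last-or x xs

  blocks-++ : ∀ q xs ys → blocks q (xs ++ ys) ≡ blocks q xs ++ blocks (last-or q xs) ys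
  blocks-++ q [] ys = refl
  blocks-++ q (x ∷ xs) ys rewrite blocks-++ x xs ys = sym (++-assoc (block q x) (blocks x xs) _)

  block-OnRail : ∀ q {v} → OnRail v → block q v ≡ [ image v ]
  block-OnRail q {rail₁ _} _ = refl
  block-OnRail q {rail₂ _} _ = refl

  block⊆bag : ∀ q v {g} → g ∈ block q v → g ∈ bag v
  block⊆bag q (rail₁ _) m = m
  block⊆bag q (rail₂ _) m = m
  block⊆bag (rail₁ _) (rung _) m = m
  block⊆bag (rail₂ _) (rung j) m = reverse⁻ m
  block⊆bag (rung _) (rung j) m = reverse⁻ m

  ∈-blocks⁻ : ∀ q xs {g} → g ∈ blocks q xs → ∃[ v ] (v ∈ xs × g ∈ bag v)
  ∈-blocks⁻ q (x ∷ xs) m with ∈-++⁻ (block q x) m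
  ... | inj₁ m′ = x , here refl , block⊆bag q x m′
  ... | inj₂ m′ with ∈-blocks⁻ x xs m′
  ...   | v , v∈ , g∈ = v , there v∈ , g∈

  image∈bag : ∀ {v} → OnRail v → image v ∈ bag v
  image∈bag {rail₁ _} _ = here refl
  image∈bag {rail₂ _} _ = here refl

  ∈-lift⁻ : ∀ {p} W {g} → OnRail p → g ∈ lift p W → ∃[ v ] (v ∈ p ∷ W × g ∈ bag v)
  ∈-lift⁻ {p} W p-on (here refl) = p , here refl , image∈bag p-on
  ∈-lift⁻ {p} W p-on (there m) with ∈-blocks⁻ p W m
  ... | v , v∈ , g∈ = v , there v∈ , g∈

  image∈blocks : ∀ q xs {v} → v ∈ xs → OnRail v → image v ∈ blocks q xs
  image∈blocks q (x ∷ xs) (here refl) v-on rewrite block-OnRail q v-on = here refl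
  image∈blocks q (x ∷ xs) (there m) v-on = ∈-++⁺ʳ (block q x) (image∈blocks x xs m v-on)

  image∈lift : ∀ p W {v} → v ∈ p ∷ W → OnRail v → image v ∈ lift p W
  image∈lift p W (here refl) _ = here refl
  image∈lift p W (there m) v-on = there (image∈blocks p W m v-on)

  bags-disjoint : ∀ v w {g} → g ∈ bag v → g ∈ bag w → v ≡ w
  bags-disjoint (rail₁ i) (rail₁ i′) (here refl) (here e) = cong rail₁ (lookup-injective P₁ (proj₁ (proj₂ P₁-path)) e)
  bags-disjoint (rail₂ i) (rail₂ i′) (here refl) (here e) = cong rail₂ (lookup-injective P₂ (proj₁ (proj₂ P₂-path)) e)
  bags-disjoint (rail₁ i) (rail₂ i′) (here refl) (here e) =
    ⊥-elim (P₁∩P₂=∅ _ (∈-lookup i) (subst (_∈ P₂) (sym e) (∈-lookup i′)))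
  bags-disjoint (rail₂ i) (rail₁ i′) (here refl) (here e) =
    ⊥-elim (P₁∩P₂=∅ _ (subst (_∈ P₁) (sym e) (∈-lookup i′)) (∈-lookup i))
  bags-disjoint (rail₁ i) (rung j) (here refl) m = ⊥-elim (proj₁ (Oriented.interior-avoids (oriented j) _ m) (∈-lookup i))
  bags-disjoint (rail₂ i) (rung j) (here refl) m = ⊥-elim (proj₂ (Oriented.interior-avoids (oriented j) _ m) (∈-lookup i))
  bags-disjoint (rung j) (rail₁ i) m (here refl) = ⊥-elim (proj₁ (Oriented.interior-avoids (oriented j) _ m) (∈-lookup i))
  bags-disjoint (rung j) (rail₂ i) m (here refl) = ⊥-elim (proj₂ (Oriented.interior-avoids (oriented j) _ m) (∈-lookup i))
  bags-disjoint (rung j) (rung j′) m m′ = cong rung (shared⇒same (interior⊆Q j m) (interior⊆Q j′ m′))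

  image-injective : ∀ {v w} → OnRail v → OnRail w → image v ≡ image w → v ≡ w
  image-injective {v} {w} v-on w-on e = bags-disjoint v w (image∈bag v-on) (subst (_∈ bag w) (sym e) (image∈bag w-on))

  block-unique : ∀ q v → Unique (block q v)
  block-unique q (rail₁ _) = Unique-cons (λ ()) []
  block-unique q (rail₂ _) = Unique-cons (λ ()) []
  block-unique (rail₁ _) (rung j) = interior-unique j
  block-unique (rail₂ _) (rung j) = Unique-reverse (interior j) (interior-unique j)
  block-unique (rung _) (rung j) = Unique-reverse (interior j) (interior-unique j)

  blocks-unique : ∀ q xs → Unique xs → Unique (blocks q xs)
  blocks-unique q [] _ = []
  blocks-unique q (x ∷ xs) u = Unique-++⁺ {xs = block q x} (block-unique q x) (blocks-unique x xs (Unique-tail u)) disjoint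
    where
    disjoint : ∀ {g} → g ∈ block q x → g ∉ blocks x xs
    disjoint g∈ g∈′ with ∈-blocks⁻ x xs g∈′
    ... | v , v∈ , g∈bag = Unique[x∷xs]⇒x∉xs u (subst (_∈ xs) (sym (bags-disjoint x v (block⊆bag q x g∈) g∈bag)) v∈)

  lift-unique : ∀ p W → OnRail p → Unique (p ∷ W) → Unique (lift p W)
  lift-unique p W p-on u = Unique-cons image∉ (blocks-unique p W (Unique-tail u))
    where
    image∉ : image p ∉ blocks p W
    image∉ m with ∈-blocks⁻ p W m
    ... | v , v∈ , g∈ = Unique[x∷xs]⇒x∉xs u (subst (_∈ W) (sym (bags-disjoint p v (image∈bag p-on) g∈)) v∈)

  bag⊆H : ∀ v {g} → g ∈ bag v → InH-V P₁ P₂ Q g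
  bag⊆H (rail₁ i) (here refl) = inj₁ (∈-lookup i)
  bag⊆H (rail₂ i) (here refl) = inj₂ (inj₁ (∈-lookup i))
  bag⊆H (rung j) m = inj₂ (inj₂ (j , interior⊆Q j m))

  segment : Vertex → Vertex → Vertex → List (Fin n)
  segment x c y = image x ∷ block x c ∷ʳ image y

  segment-is-Q : ∀ {j x y} → x ∼ rung j → rung j ∼ y → x ≢ y →
    segment x (rung j) y ≡ forward j ⊎ segment x (rung j) y ≡ reverse (forward j)
  segment-is-Q {j} x∼ ∼y x≢y with rung-ends (∼-sym x∼) | rung-ends ∼y
  ... | inj₁ refl | inj₁ refl = ⊥-elim (x≢y refl)
  ... | inj₂ refl | inj₂ refl = ⊥-elim (x≢y refl)
  ... | inj₁ refl | inj₂ refl = inj₁ (cong₂ (λ a b → a ∷ interior j ∷ʳ b) (lookup-at₁ j) (lookup-at₂ j))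
  ... | inj₂ refl | inj₁ refl = inj₂ (trans (cong₂ (λ a b → a ∷ reverse (interior j) ∷ʳ b) (lookup-at₂ j) (lookup-at₁ j))
                                        (sym reverse-forward))
    where
    reverse-forward : reverse (forward j) ≡ finish j ∷ reverse (interior j) ∷ʳ start j
    reverse-forward rewrite unfold-reverse (start j) (interior j ∷ʳ finish j) | reverse-++ (interior j) [ finish j ] = refl

  segment-EdgeH : ∀ {j x y} → x ∼ rung j → rung j ∼ y → x ≢ y →
    ∀ {u v} → Consecutive u v (segment x (rung j) y) → EdgeH u v
  segment-EdgeH {j} x∼ ∼y x≢y c with segment-is-Q x∼ ∼y x≢y
  ... | inj₁ e = EdgeH-forward j (subst (Consecutive _ _) e c)
  ... | inj₂ e = EdgeH-sym (EdgeH-forward j (subst (Consecutive _ _) (reverse-involutive (forward j))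
                   (consecutive-reverse (subst (Consecutive _ _) e c))))

  rail-EdgeH : ∀ {x y} → x ∼ y → OnRail x → OnRail y → EdgeH (image x) (image y)
  rail-EdgeH {rail₁ i} {rail₁ i′} (inj₁ e) _ _ = EdgeH-P₁ (consecutive-lookup P₁ e)
  rail-EdgeH {rail₁ i} {rail₁ i′} (inj₂ e) _ _ = EdgeH-sym (EdgeH-P₁ (consecutive-lookup P₁ e))
  rail-EdgeH {rail₂ i} {rail₂ i′} (inj₁ e) _ _ = EdgeH-P₂ (consecutive-lookup P₂ e)
  rail-EdgeH {rail₂ i} {rail₂ i′} (inj₂ e) _ _ = EdgeH-sym (EdgeH-P₂ (consecutive-lookup P₂ e))

  -- The hypotheses only serve to ensure that every rung is entered and left through different vertices.
  lift-Linked : ∀ p ws z → OnRail p → OnRail z → Linked _∼_ (p ∷ ws ∷ʳ z) → Unique (p ∷ ws) → z ∉ ws →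
    p ≢ z ⊎ 2 ≤ length ws → Linked EdgeH (lift p (ws ∷ʳ z))
  lift-Linked p [] z p-on z-on (p∼z ∷ [-]) _ _ _ rewrite block-OnRail p z-on = rail-EdgeH p∼z p-on z-on ∷ [-]
  lift-Linked p (rail₁ i ∷ ws) z p-on z-on (p∼ ∷ linked) u z∉ _ =
    rail-EdgeH p∼ p-on tt ∷
      lift-Linked (rail₁ i) ws z tt z-on linked (Unique-tail u) (λ m → z∉ (there m)) (inj₁ (λ e → z∉ (here (sym e))))
  lift-Linked p (rail₂ i ∷ ws) z p-on z-on (p∼ ∷ linked) u z∉ _ =
    rail-EdgeH p∼ p-on tt ∷
      lift-Linked (rail₂ i) ws z tt z-on linked (Unique-tail u) (λ m → z∉ (there m)) (inj₁ (λ e → z∉ (here (sym e))))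
  lift-Linked p (rung j ∷ []) z p-on z-on (p∼ ∷ ∼z ∷ [-]) _ _ p≢z⊎ rewrite block-OnRail (rung j) z-on =
    consecutive⇒Linked (segment p (rung j) z) (segment-EdgeH p∼ ∼z (p≢z p≢z⊎))
    where
    p≢z : p ≢ z ⊎ 2 ≤ 1 → p ≢ z
    p≢z (inj₁ p≢z) = p≢z
    p≢z (inj₂ (s≤s ()))
  lift-Linked p (rung j ∷ y ∷ ws) z p-on z-on (p∼ ∷ ∼y ∷ linked) u z∉ _
    rewrite block-OnRail (rung j) (rung-neighbour-OnRail ∼y) =
    Linked-join (image p ∷ block p (rung j)) (consecutive⇒Linked (segment p (rung j) y) (segment-EdgeH p∼ ∼y p≢y))
      (lift-Linked y ws z (rung-neighbour-OnRail ∼y) z-on linked (Unique-tail (Unique-tail u)) (λ m → z∉ (there (there m)))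
        (inj₁ (λ e → z∉ (there (here (sym e))))))
    where
    p≢y : p ≢ y
    p≢y e = Unique[x∷xs]⇒x∉xs u (there (here e))

  closeCycle-lift : ∀ p W → OnRail p → closeCycle (lift p W) ≡ image p ∷ blocks p (W ∷ʳ p)
  closeCycle-lift p W p-on rewrite blocks-++ p W [ p ] | block-OnRail (last-or p W) p-on = refl

  ∈-closeCycle⁻ : ∀ {A : Set} (xs : List A) {v} → v ∈ closeCycle xs → v ∈ xs
  ∈-closeCycle⁻ xs m with ∈-++⁻ xs m
  ... | inj₁ m′ = m′
  ∈-closeCycle⁻ (x ∷ xs) m | inj₂ (here refl) = here refl

  PathInCycle-of-segment : ∀ j O ls sg rs → closeCycle O ≡ ls ++ sg ++ rs → sg ≡ forward j ⊎ sg ≡ reverse (forward j) →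
    PathInCycle (Q j) O
  PathInCycle-of-segment j O ls sg rs split orientation = (λ v → in-O ∘ to-sg orientation ∘ ∈-forward⁺ j) , edge
    where
    in-O : ∀ {v} → v ∈ sg → v ∈ O
    in-O m = ∈-closeCycle⁻ O (subst (_ ∈_) (sym split) (∈-++⁺ʳ ls (∈-++⁺ˡ m)))
    to-sg : ∀ {v} → sg ≡ forward j ⊎ sg ≡ reverse (forward j) → v ∈ forward j → v ∈ sg
    to-sg (inj₁ refl) m = m
    to-sg (inj₂ refl) m = reverse⁺ m
    on-sg : ∀ {u v} → sg ≡ forward j ⊎ sg ≡ reverse (forward j) → Consecutive u v (Q j) →
      Consecutive u v sg ⊎ Consecutive v u sg
    on-sg o c with consecutive-forward⁺ j c | o
    ... | inj₁ d | inj₁ refl = inj₁ d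
    ... | inj₂ d | inj₁ refl = inj₂ d
    ... | inj₁ d | inj₂ refl = inj₂ (consecutive-reverse d)
    ... | inj₂ d | inj₂ refl = inj₁ (consecutive-reverse d)
    in-cycle : ∀ {u v} → Consecutive u v sg → Consec u v (closeUp O)
    in-cycle c = Consecutive⇒Consec (subst (Consecutive _ _) (sym split) (consecutive-++ʳ ls (consecutive-++ˡ rs c)))
    edge : ∀ u v → PathEdge (Q j) u v → CycleEdge O u v
    edge u v (inj₁ c) = Sum.map in-cycle in-cycle (on-sg orientation (Consec⇒Consecutive c))
    edge u v (inj₂ c) = Sum.swap (Sum.map in-cycle in-cycle (on-sg orientation (Consec⇒Consecutive c)))

  lift-split-first : ∀ p c y ys → OnRail y → lift p (c ∷ y ∷ ys) ≡ segment p c y ++ blocks y ys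
  lift-split-first p c y ys y-on rewrite block-OnRail c y-on = cong (image p ∷_) (sym (++-assoc (block p c) [ image y ] (blocks y ys)))

  lift-split : ∀ p xs x c y ys → OnRail x → OnRail y →
    lift p (xs ++ x ∷ c ∷ y ∷ ys) ≡ lift p xs ++ segment x c y ++ blocks y ys
  lift-split p xs x c y ys x-on y-on rewrite blocks-++ p xs (x ∷ c ∷ y ∷ ys) | block-OnRail (last-or p xs) x-on
    | block-OnRail c y-on | ++-assoc (block x c) [ image y ] (blocks y ys) = refl

  rung-ends-distinct : ∀ {j j′ u v} → rung j ∼ u → rung j′ ∼ v → j ≢ j′ → u ≢ v
  rung-ends-distinct ∼u ∼v j≢j′ e with rung-ends ∼u | rung-ends ∼v
  ... | inj₁ refl | inj₁ e′ = j≢j′ (at₁-injective (rail₁-injective (trans e e′)))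
  ... | inj₂ refl | inj₂ e′ = j≢j′ (at₂-injective (rail₂-injective (trans e e′)))
  rung-ends-distinct ∼u ∼v j≢j′ refl | inj₁ refl | inj₂ ()
  rung-ends-distinct ∼u ∼v j≢j′ refl | inj₂ refl | inj₁ ()

  record Lifted (C : List Vertex) : Set where
    field
      cycle : List (Fin n)
      good : CycleInH G P₁ P₂ Q cycle × ContainsTwo Q cycle
      ⊆bags : ∀ {g} → g ∈ cycle → ∃[ v ] (v ∈ C × g ∈ bag v)

  module _ {C} (two : TwoRungs C) where

    open TwoRungs two
    open PassesRung second using (before; after)
      renaming (x to x′; j to j′; y to y′; split to split′; x∼j to x∼j′; j∼y to j′∼y′; x≢y to x′≢y′)

    private
      W : List Vertex
      W = rung j ∷ y ∷ rest
      O : List (Fin n)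
      O = lift p W
      u : Unique (p ∷ W)
      u = proj₁ (proj₂ cycle)
      p-on : OnRail p
      p-on = rung-neighbour-OnRail (∼-sym p∼j)
      y-on : OnRail y
      y-on = rung-neighbour-OnRail j∼y
      x′-on : OnRail x′
      x′-on = rung-neighbour-OnRail (∼-sym x∼j′)
      y′-on : OnRail y′
      y′-on = rung-neighbour-OnRail j′∼y′

    lift-two-rungs-Linked : Linked EdgeH (closeCycle O)
    lift-two-rungs-Linked = subst (Linked EdgeH) (sym (closeCycle-lift p W p-on))
      (lift-Linked p W p p-on p-on (proj₂ (proj₂ cycle)) u (Unique[x∷xs]⇒x∉xs u) (inj₂ (s≤s (s≤s z≤n))))

    lift-two-rungs-IsCycle : IsCycle G O
    lift-two-rungs-IsCycle =
      3≤length (here refl) (image∈lift p W (there (there (here refl))) y-on) (image∈lift p W x′∈ x′-on)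
        (p≢y ∘ image-injective p-on y-on)
        (rung-ends-distinct (∼-sym p∼j) (∼-sym x∼j′) j≢j′ ∘ image-injective p-on x′-on)
        (rung-ends-distinct j∼y (∼-sym x∼j′) j≢j′ ∘ image-injective y-on x′-on) ,
      lift-unique p W p-on u , Linked.map proj₁ lift-two-rungs-Linked
      where
      x′∈ : x′ ∈ p ∷ W
      x′∈ with ∈-++⁻ (y ∷ rest) (subst (x′ ∈_) (sym split′) (∈-++⁺ʳ before (here refl)))
      ... | inj₁ m = there (there m)
      ... | inj₂ (here e) = here e

    lift-two-rungs-edges : ∀ a b → CycleEdge O a b → InH-E P₁ P₂ Q a b
    lift-two-rungs-edges a b (inj₁ c) = proj₂ (Linked⇒consecutive lift-two-rungs-Linked (Consec⇒Consecutive c))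
    lift-two-rungs-edges a b (inj₂ c) = proj₂ (EdgeH-sym (Linked⇒consecutive lift-two-rungs-Linked (Consec⇒Consecutive c)))

    lift-two-rungs-ContainsTwo : ContainsTwo Q O
    lift-two-rungs-ContainsTwo = j , j′ , j≢j′ ,
      PathInCycle-of-segment j O [] (segment p (rung j) y) (blocks y (rest ∷ʳ p))
        (trans (closeCycle-lift p W p-on) (lift-split-first p (rung j) y (rest ∷ʳ p) y-on)) (segment-is-Q p∼j j∼y p≢y) ,
      PathInCycle-of-segment j′ O (lift p (rung j ∷ before)) (segment x′ (rung j′) y′) (blocks y′ after)
        (trans (closeCycle-lift p W p-on) (trans (cong (λ zs → image p ∷ blocks p (rung j ∷ zs)) split′)
          (lift-split p (rung j ∷ before) x′ (rung j′) y′ after x′-on y′-on)))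
        (segment-is-Q x∼j′ j′∼y′ x′≢y′)

    lift-two-rungs : Lifted C
    lift-two-rungs = record
      { cycle = O
      ; good = (lift-two-rungs-IsCycle , (λ g m → in-H (∈-lift⁻ W p-on m)) , lift-two-rungs-edges) ,
               lift-two-rungs-ContainsTwo
      ; ⊆bags = λ m → in-C (∈-lift⁻ W p-on m)
      }
      where
      in-H : ∀ {g} → ∃[ v ] (v ∈ p ∷ W × g ∈ bag v) → InH-V P₁ P₂ Q g
      in-H (v , _ , g∈) = bag⊆H v g∈
      in-C : ∀ {g} → ∃[ v ] (v ∈ p ∷ W × g ∈ bag v) → ∃[ v ] (v ∈ C × g ∈ bag v)
      in-C (v , v∈ , g∈) = v , ⊆C v∈ , g∈

  -- Opaque, so that checking the disjointness of lifted cycles does not unfold their construction.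
  opaque
    lift-cycle : ∀ C → IsCycleOf _∼_ C → Lifted C
    lift-cycle C c = lift-two-rungs (cycle-has-two-rungs C c)

  lift-disjoint-cycles : ∀ {k} → DisjointCycles k (IsCycle ladder-graph) →
    DisjointCycles k (λ C → CycleInH G P₁ P₂ Q C × ContainsTwo Q C)
  lift-disjoint-cycles (Cs , cycles , disjoint) = Lifted.cycle ∘ lifted , Lifted.good ∘ lifted , disjoint′
    where
    lifted : ∀ i → Lifted (map decode (Cs i))
    lifted i = lift-cycle _ (decode-cycle (cycles i))
    disjoint′ : ∀ i j → i ≢ j → Disjoint (Lifted.cycle (lifted i)) (Lifted.cycle (lifted j))
    disjoint′ i j i≢j g g∈i g∈j = apart (Lifted.⊆bags (lifted i) g∈i) (Lifted.⊆bags (lifted j) g∈j)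
      where
      apart : ∃[ v ] (v ∈ map decode (Cs i) × g ∈ bag v) → ∃[ w ] (w ∈ map decode (Cs j) × g ∈ bag w) → ⊥
      apart (v , v∈ , g∈v) (w , w∈ , g∈w) with ∈-map⁻ decode v∈ | ∈-map⁻ decode w∈
      ... | x , x∈ , refl | y , y∈ , refl =
        disjoint i j i≢j x x∈ (subst (_∈ Cs j) (sym (decode-injective (bags-disjoint (decode x) (decode y) g∈v g∈w))) y∈)

  open CycleAvoiding (length P₁) (length P₂) ℓ at₁ at₂ at₁-injective at₂-injective public
    using (no-small-feedback-vertex-set)

2^-cancel-≤ : ∀ {a b} → 2 ^ a ≤ 2 ^ b → a ≤ b
2^-cancel-≤ {a} {b} 2^a≤2^b with a ≤? b
... | yes a≤b = a≤b
... | no a≰b = ⊥-elim (<⇒≱ (^-monoʳ-< 2 (s≤s (s≤s z≤n)) (≰⇒> a≰b)) 2^a≤2^b)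

3*m+2≤ℓ : ∀ p q m k ℓ → 1 ≤ q → LeCKlogK p q m k → GeTwoPlus3CKlogK p q ℓ k → 3 * m + 2 ≤ ℓ
3*m+2≤ℓ p q@(suc _) m k ℓ _ m-small (2≤ℓ , ℓ-large) =
  subst (3 * m + 2 ≤_) (m∸n+n≡m 2≤ℓ) (+-monoˡ-≤ 2 (*-cancelˡ-≤ q (2^-cancel-≤ powers)))
  where
  open ≤-Reasoning
  powers : 2 ^ (q * (3 * m)) ≤ 2 ^ (q * (ℓ ∸ 2))
  powers = begin
    2 ^ (q * (3 * m))   ≡⟨ cong (2 ^_) (trans (cong (q *_) (*-comm 3 m)) (sym (*-assoc q m 3))) ⟩
    2 ^ (q * m * 3)     ≡⟨ sym (^-*-assoc 2 (q * m) 3) ⟩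
    (2 ^ (q * m)) ^ 3   ≤⟨ ^-monoˡ-≤ 3 m-small ⟩
    ((k ^ k) ^ p) ^ 3   ≤⟨ ℓ-large ⟩
    2 ^ (q * (ℓ ∸ 2))   ∎

lemma2p8 : (p q : ℕ) → 1 ≤ q → q ≤ p → ErdosPosa p q →
    (k : ℕ) → 1 ≤ k → (n : ℕ) (G : Graph n) →
    (P₁ P₂ : List (Fin n)) → IsPath G P₁ → IsPath G P₂ → Disjoint P₁ P₂ →
    (ℓ : ℕ) (Q : Fin ℓ → List (Fin n)) →
    (∀ i → IsPath G (Q i)) →
    (∀ i j → i ≢ j → Disjoint (Q i) (Q j)) →
    (∀ i → Connects P₁ P₂ (Q i)) →
    GeTwoPlus3CKlogK p q ℓ k →
    DisjointCycles k (λ C → CycleInH G P₁ P₂ Q C × ContainsTwo Q C)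
lemma2p8 p q 1≤q _ erdős-pósa k 1≤k n G P₁ P₂ P₁-path P₂-path P₁∩P₂=∅ ℓ Q Q-path Q-disjoint Q-connects ℓ-large =
  [ lift-disjoint-cycles
  , (λ (X , hitting , X-small) → ⊥-elim (no-small-feedback-vertex-set X hitting (3*m+2≤ℓ p q _ k ℓ 1≤q X-small ℓ-large)))
  ]′ (erdős-pósa k 1≤k _ ladder-graph)
  where open Lifting G P₁ P₂ P₁-path P₂-path P₁∩P₂=∅ ℓ Q Q-path Q-disjoint Q-connects
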